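{- Let $N=3$ and $\eta=e^{2\pi i/3}$. Then $\omega^3_{0;1}=(\eta^2-1)/3$ and for all $n\ge1$ $$\omega^3_{2n-1;1}=\omega^3_{2n-1;2}=\frac{(3^{2n}-1)B_{2n}}{4n},\qquad \omega^3_{2n;1}=-\omega^3_{2n;2}=-\frac{\sqrt{ -3}}{6(2n+1)}\sum_{j=0}^{2n}3^{2n-j}(2^{j+1}-1)\binom{2n+1}{2n-j}B_{2n-j}.$$
   Context: For $\alpha\in\mathbb Z/3\mathbb Z$, $\omega^3_{n;\alpha}$ ($n\ge0$) is defined by $\frac{1}{\eta^\alpha e^x-1}=\frac{\delta_{\alpha,0}}{x}+\sum_{n\ge0}\frac{\omega^3_{n;\alpha}}{n!}x^n$. Bernoulli numbers: $\frac{x}{e^x-1}=\sum_{m\ge0}B_m\frac{x^m}{m!}$. $\sqrt{ -3}=i\sqrt3$. -}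

module Defs where

open import Data.Nat as ℕ using (ℕ; zero; suc; _∸_; _^_)
open import Data.Nat.Combinatorics using (_C_)
open import Data.Integer using (+_)
open import Data.Rational as ℚ using (ℚ; 0ℚ; 1ℚ; _/_)

fromℕ : ℕ → ℚ
fromℕ k = (+ k) / 1

record Q3 : Set where
  constructor _⊕_√-3
  field
    re : ℚ
    im : ℚ
open Q3 public

infixl 6 _+₃_ _-₃_
infixl 7 _*₃_

_+₃_ : Q3 → Q3 → Q3
(a ⊕ b √-3) +₃ (c ⊕ d √-3) = (a ℚ.+ c) ⊕ (b ℚ.+ d) √-3

-₃_ : Q3 → Q3
-₃ (a ⊕ b √-3) = (ℚ.- a) ⊕ (ℚ.- b) √-3

_-₃_ : Q3 → Q3 → Q3
x -₃ y = x +₃ (-₃ y)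

_*₃_ : Q3 → Q3 → Q3
(a ⊕ b √-3) *₃ (c ⊕ d √-3) =
  (a ℚ.* c ℚ.- fromℕ 3 ℚ.* (b ℚ.* d)) ⊕ (a ℚ.* d ℚ.+ b ℚ.* c) √-3

ι : ℚ → Q3
ι a = a ⊕ 0ℚ √-3

0₃ 1₃ √-3 : Q3
0₃ = ι 0ℚ
1₃ = ι 1ℚ
√-3 = 0ℚ ⊕ 1ℚ √-3

-- η = e^{2πi/3} = -1/2 + (1/2)√-3
η : Q3
η = (ℚ.- ℚ.½) ⊕ ℚ.½ √-3

_^₃_ : Q3 → ℕ → Q3
x ^₃ zero = 1₃
x ^₃ suc k = x *₃ (x ^₃ k)

sumQ : ℕ → (ℕ → ℚ) → ℚ
sumQ zero f = f 0
sumQ (suc n) f = sumQ n f ℚ.+ f (suc n)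

sum₃ : ℕ → (ℕ → Q3) → Q3
sum₃ zero f = f 0
sum₃ (suc n) f = sum₃ n f +₃ f (suc n)

-- Product of exponential generating functions:
-- (Σ f_n x^n/n!)(Σ g_n x^n/n!) = Σ (Σ_k C(n,k) f_k g_{n-k}) x^n/n!
egf*₃ : (ℕ → Q3) → (ℕ → Q3) → ℕ → Q3
egf*₃ f g n = sum₃ n (λ k → ι (fromℕ (n C k)) *₃ (f k *₃ g (n ∸ k)))

egf*Q : (ℕ → ℚ) → (ℕ → ℚ) → ℕ → ℚ
egf*Q f g n = sumQ n (λ k → fromℕ (n C k) ℚ.* (f k ℚ.* g (n ∸ k)))

oneQ : ℕ → ℚ
oneQ zero = 1ℚ
oneQ (suc _) = 0ℚ

one₃ : ℕ → Q3
one₃ n = ι (oneQ n)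

-- EGF coefficients of  c·e^x - 1  : (c - 1), c, c, c, ...
ceˣ-1 : Q3 → ℕ → Q3
ceˣ-1 c zero = c -₃ 1₃
ceˣ-1 c (suc _) = c

-- EGF coefficients of (e^x - 1)/x = Σ x^k/(k+1)! : the k-th is 1/(k+1)
eˣ-1/x : ℕ → ℚ
eˣ-1/x k = (+ 1) / suc k

-- ω^3_{n;α} for α ∈ {1,2} (δ_{α,0} = 0):  1/(η^α e^x - 1) = Σ ω_n x^n/n!,
-- i.e. (η^α e^x - 1) · Σ ω_n x^n/n! = 1 as formal power series.
IsOmega3 : ℕ → (ℕ → Q3) → Set
IsOmega3 α ω = ∀ n → egf*₃ (ceˣ-1 (η ^₃ α)) ω n ≡ one₃ n
  where open import Relation.Binary.PropositionalEquality using (_≡_)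

-- Bernoulli numbers:  x/(e^x - 1) = Σ B_m x^m/m!,
-- i.e. ((e^x - 1)/x) · Σ B_m x^m/m! = 1 as formal power series.
IsBernoulli : (ℕ → ℚ) → Set
IsBernoulli B = ∀ n → egf*Q eˣ-1/x B n ≡ oneQ n
  where open import Relation.Binary.PropositionalEquality using (_≡_)

{-# OPTIONS --safe #-}
-- Work in the ring of exponential generating functions over ℚ(√-3), where the
-- hypotheses say ω₁ = 1/(ηeˣ - 1), ω₂ = 1/(η²eˣ - 1) and Σ B_m x^m/m! = x/(eˣ - 1).
-- Because η³ = 1, (ηeˣ - 1)(η²eˣ - 1) = e²ˣ + eˣ + 1 = (e³ˣ - 1)/(eˣ - 1), so
-- 3ω₁ω₂ = ((eˣ - 1)/x)·(3x/(e³ˣ - 1)).  Writing ω₁ ± ω₂ = ω₁ω₂(c₂ ± c₁) with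
-- c_α = η^α eˣ - 1 then gives
--   3x(ω₁ + ω₂) = 3(3x/(e³ˣ - 1) - x/(eˣ - 1)),
--   3(ω₁ - ω₂)  = (η² - η) eˣ ((eˣ - 1)/x) (3x/(e³ˣ - 1)),
-- whose coefficients are the Bernoulli expressions of the statement.  Finally
-- ω₂(x) = -1 - ω₁(-x), so ω₂ equals ω₁ in odd and -ω₁ in positive even degree,
-- and each of the two identities determines ω₁ there.
module Submission where

open import Defs
open import Data.Nat as ℕ using (ℕ; zero; suc; _∸_; _^_; _+_; _*_; _≤_; z≤n; s≤s)
import Data.Nat.Properties as ℕP
open import Data.Nat.Combinatorics
  using (_C_; nCk+nC[k+1]≡[n+1]C[k+1]; nCk≡nC[n∸k]; nC1≡n; k>n⇒nCk≡0)
import Data.Nat.Solver as ℕSolver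
open import Data.Integer as ℤ using (+_)
import Data.Integer.Properties as ℤP
open import Data.Rational as ℚ using (ℚ; _/_; 0ℚ; 1ℚ)
import Data.Rational.Properties as ℚP
import Data.Rational.Solver as ℚSolver
import Data.Nat.Coprimality as Coprimality
open import Data.Product using (_×_; _,_)
open import Data.Maybe using (Maybe; just; nothing)
open import Function using (_∘_)
open import Relation.Nullary using (yes; no)
open import Relation.Binary.Definitions using (Decidable)
open import Relation.Binary.Structures using (IsEquivalence)
open import Relation.Binary.PropositionalEquality
open import Algebra.Bundles using (CommutativeRing)
open import Algebra.Structures using (IsCommutativeRing)
import Algebra.Solver.Ring as RingSolver
import Relation.Binary.Reasoning.Setoid as SetoidReasoning
import Algebra.Solver.Ring.Simple as SimpleRingSolver
import Algebra.Solver.Ring.AlmostCommutativeRing as ACR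

-- The field ℚ(√-3)

private
  fromℕ≡mkℚ : ∀ n → fromℕ n ≡ ℚ.mkℚ (+ n) 0 (Coprimality.sym (Coprimality.1-coprimeTo n))
  fromℕ≡mkℚ n = ℚP.normalize-coprime (Coprimality.sym (Coprimality.1-coprimeTo n))

fromℕ-+ : ∀ m n → fromℕ (m + n) ≡ fromℕ m ℚ.+ fromℕ n
fromℕ-+ m n = sym (trans (cong₂ ℚ._+_ (fromℕ≡mkℚ m) (fromℕ≡mkℚ n))
  (ℚP./-cong (trans (cong₂ ℤ._+_ (ℤP.*-identityʳ (+ m)) (ℤP.*-identityʳ (+ n))) (sym (ℤP.pos-+ m n))) refl))

fromℕ-* : ∀ m n → fromℕ (m * n) ≡ fromℕ m ℚ.* fromℕ n
fromℕ-* m n = sym (trans (cong₂ ℚ._*_ (fromℕ≡mkℚ m) (fromℕ≡mkℚ n))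
  (ℚP./-cong (sym (ℤP.pos-* m n)) refl))

1/[1+n]*[1+n]≡1 : ∀ n → ((+ 1) / suc n) ℚ.* fromℕ (suc n) ≡ 1ℚ
1/[1+n]*[1+n]≡1 n = trans
  (cong₂ ℚ._*_ (ℚP.normalize-coprime (Coprimality.1-coprimeTo (suc n))) (fromℕ≡mkℚ (suc n)))
  (ℚP.*-inverseˡ (ℚ.mkℚ (+ suc n) 0 (Coprimality.sym (Coprimality.1-coprimeTo (suc n)))))

+₃-assoc : ∀ x y z → (x +₃ y) +₃ z ≡ x +₃ (y +₃ z)
+₃-assoc x y z = cong₂ _⊕_√-3 (ℚP.+-assoc (re x) (re y) (re z)) (ℚP.+-assoc (im x) (im y) (im z))

+₃-comm : ∀ x y → x +₃ y ≡ y +₃ x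
+₃-comm x y = cong₂ _⊕_√-3 (ℚP.+-comm (re x) (re y)) (ℚP.+-comm (im x) (im y))

+₃-identityˡ : ∀ x → 0₃ +₃ x ≡ x
+₃-identityˡ x = cong₂ _⊕_√-3 (ℚP.+-identityˡ (re x)) (ℚP.+-identityˡ (im x))

+₃-identityʳ : ∀ x → x +₃ 0₃ ≡ x
+₃-identityʳ x = cong₂ _⊕_√-3 (ℚP.+-identityʳ (re x)) (ℚP.+-identityʳ (im x))

-₃-inverseˡ : ∀ x → (-₃ x) +₃ x ≡ 0₃
-₃-inverseˡ x = cong₂ _⊕_√-3 (ℚP.+-inverseˡ (re x)) (ℚP.+-inverseˡ (im x))

-₃-inverseʳ : ∀ x → x +₃ (-₃ x) ≡ 0₃
-₃-inverseʳ x = cong₂ _⊕_√-3 (ℚP.+-inverseʳ (re x)) (ℚP.+-inverseʳ (im x))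

*₃-assoc : ∀ x y z → (x *₃ y) *₃ z ≡ x *₃ (y *₃ z)
*₃-assoc (a ⊕ b √-3) (c ⊕ d √-3) (e ⊕ f √-3) = cong₂ _⊕_√-3
  (solve 7 (λ a b c d e f t → (a :* c :- t :* (b :* d)) :* e :- t :* ((a :* d :+ b :* c) :* f)
                            := a :* (c :* e :- t :* (d :* f)) :- t :* (b :* (c :* f :+ d :* e)))
     refl a b c d e f (fromℕ 3))
  (solve 7 (λ a b c d e f t → (a :* c :- t :* (b :* d)) :* f :+ (a :* d :+ b :* c) :* e
                            := a :* (c :* f :+ d :* e) :+ b :* (c :* e :- t :* (d :* f)))
     refl a b c d e f (fromℕ 3))
  where open ℚSolver.+-*-Solver

*₃-comm : ∀ x y → x *₃ y ≡ y *₃ x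
*₃-comm (a ⊕ b √-3) (c ⊕ d √-3) = cong₂ _⊕_√-3
  (solve 5 (λ a b c d t → a :* c :- t :* (b :* d) := c :* a :- t :* (d :* b)) refl a b c d (fromℕ 3))
  (solve 4 (λ a b c d → a :* d :+ b :* c := c :* b :+ d :* a) refl a b c d)
  where open ℚSolver.+-*-Solver

*₃-identityˡ : ∀ x → 1₃ *₃ x ≡ x
*₃-identityˡ (a ⊕ b √-3) = cong₂ _⊕_√-3
  (solve 3 (λ a b t → con 1ℚ :* a :- t :* (con 0ℚ :* b) := a) refl a b (fromℕ 3))
  (solve 2 (λ a b → con 1ℚ :* b :+ con 0ℚ :* a := b) refl a b)
  where open ℚSolver.+-*-Solver

*₃-distribˡ : ∀ x y z → x *₃ (y +₃ z) ≡ (x *₃ y) +₃ (x *₃ z)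
*₃-distribˡ (a ⊕ b √-3) (c ⊕ d √-3) (e ⊕ f √-3) = cong₂ _⊕_√-3
  (solve 7 (λ a b c d e f t → a :* (c :+ e) :- t :* (b :* (d :+ f))
                            := (a :* c :- t :* (b :* d)) :+ (a :* e :- t :* (b :* f)))
     refl a b c d e f (fromℕ 3))
  (solve 6 (λ a b c d e f → a :* (d :+ f) :+ b :* (c :+ e) := (a :* d :+ b :* c) :+ (a :* f :+ b :* e))
     refl a b c d e f)
  where open ℚSolver.+-*-Solver

*₃-identityʳ : ∀ x → x *₃ 1₃ ≡ x
*₃-identityʳ x = trans (*₃-comm x 1₃) (*₃-identityˡ x)

*₃-distribʳ : ∀ x y z → (y +₃ z) *₃ x ≡ (y *₃ x) +₃ (z *₃ x)
*₃-distribʳ x y z =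
  trans (*₃-comm (y +₃ z) x) (trans (*₃-distribˡ x y z) (cong₂ _+₃_ (*₃-comm x y) (*₃-comm x z)))

ℚ[√-3]-isCommutativeRing : IsCommutativeRing _≡_ _+₃_ _*₃_ -₃_ 0₃ 1₃
ℚ[√-3]-isCommutativeRing = record
  { isRing = record
    { +-isAbelianGroup = record
      { isGroup = record
        { isMonoid = record
          { isSemigroup = record
            { isMagma = record { isEquivalence = isEquivalence ; ∙-cong = cong₂ _+₃_ }
            ; assoc = +₃-assoc }
          ; identity = +₃-identityˡ , +₃-identityʳ }
        ; inverse = -₃-inverseˡ , -₃-inverseʳ
        ; ⁻¹-cong = cong (λ x → -₃ x) }
      ; comm = +₃-comm }
    ; *-cong = cong₂ _*₃_
    ; *-assoc = *₃-assoc
    ; *-identity = *₃-identityˡ , *₃-identityʳ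
    ; distrib = *₃-distribˡ , *₃-distribʳ }
  ; *-comm = *₃-comm }

ℚ[√-3] : CommutativeRing _ _
ℚ[√-3] = record { isCommutativeRing = ℚ[√-3]-isCommutativeRing }

_≟₃_ : Decidable {A = Q3} _≡_
(a ⊕ b √-3) ≟₃ (c ⊕ d √-3) with a ℚP.≟ c | b ℚP.≟ d
... | yes refl | yes refl = yes refl
... | no a≢c   | _        = no (a≢c ∘ cong re)
... | yes _    | no b≢d   = no (b≢d ∘ cong im)

module ℚ[√-3]-Solver = SimpleRingSolver (ACR.fromCommutativeRing ℚ[√-3]) _≟₃_

ι-+ : ∀ p q → ι (p ℚ.+ q) ≡ ι p +₃ ι q
ι-+ p q = cong₂ _⊕_√-3 refl (sym (ℚP.+-identityˡ 0ℚ))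

ι-* : ∀ p q → ι (p ℚ.* q) ≡ ι p *₃ ι q
ι-* p q = cong₂ _⊕_√-3
  (solve 3 (λ p q t → p :* q := p :* q :- t :* (con 0ℚ :* con 0ℚ)) refl p q (fromℕ 3))
  (solve 2 (λ p q → con 0ℚ := p :* con 0ℚ :+ con 0ℚ :* q) refl p q)
  where open ℚSolver.+-*-Solver

ιℕ : ℕ → Q3
ιℕ n = ι (fromℕ n)

ιℕ-+ : ∀ m n → ιℕ (m + n) ≡ ιℕ m +₃ ιℕ n
ιℕ-+ m n = trans (cong ι (fromℕ-+ m n)) (ι-+ (fromℕ m) (fromℕ n))

ιℕ-* : ∀ m n → ιℕ (m * n) ≡ ιℕ m *₃ ιℕ n
ιℕ-* m n = trans (cong ι (fromℕ-* m n)) (ι-* (fromℕ m) (fromℕ n))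

ιℕ-^ : ∀ m k → ιℕ (m ^ k) ≡ ιℕ m ^₃ k
ιℕ-^ m zero    = refl
ιℕ-^ m (suc k) = trans (ιℕ-* m (m ^ k)) (cong (ιℕ m *₃_) (ιℕ-^ m k))

ιℕ-∸1 : ∀ {n} → 1 ≤ n → ιℕ (n ∸ 1) ≡ ιℕ n -₃ 1₃
ιℕ-∸1 {suc n} _ = begin
  ιℕ n                   ≡⟨ solve 1 (λ x → x := (con 1₃ :+ x) :- con 1₃) refl (ιℕ n) ⟩
  (1₃ +₃ ιℕ n) -₃ 1₃     ≡⟨ cong (_-₃ 1₃) (ιℕ-+ 1 n) ⟨
  ιℕ (suc n) -₃ 1₃       ∎
  where open ≡-Reasoning
        open ℚ[√-3]-Solver

[1+n]*x≡y⇒x≡y/[1+n] : ∀ n {x y} → ιℕ (suc n) *₃ x ≡ y → x ≡ ι ((+ 1) / suc n) *₃ y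
[1+n]*x≡y⇒x≡y/[1+n] n {x} {y} refl = begin
  x
    ≡⟨ *₃-identityˡ x ⟨
  1₃ *₃ x
    ≡⟨ cong (_*₃ x) (trans (sym (ι-* ((+ 1) / suc n) (fromℕ (suc n)))) (cong ι (1/[1+n]*[1+n]≡1 n))) ⟨
  (r *₃ m) *₃ x
    ≡⟨ *₃-assoc r m x ⟩
  r *₃ (m *₃ x)
    ∎
  where open ≡-Reasoning
        r m : Q3
        r = ι ((+ 1) / suc n)
        m = ιℕ (suc n)

*-cancelˡ-ιℕ[1+n] : ∀ n {x y} → ιℕ (suc n) *₃ x ≡ ιℕ (suc n) *₃ y → x ≡ y
*-cancelˡ-ιℕ[1+n] n {x} {y} eq =
  trans ([1+n]*x≡y⇒x≡y/[1+n] n eq) (sym ([1+n]*x≡y⇒x≡y/[1+n] n refl))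

sum₃-suc : ∀ n h → sum₃ (suc n) h ≡ h 0 +₃ sum₃ n (h ∘ suc)
sum₃-suc zero    h = refl
sum₃-suc (suc n) h = trans (cong (_+₃ h (suc (suc n))) (sum₃-suc n h))
  (+₃-assoc (h 0) (sum₃ n (h ∘ suc)) (h (suc (suc n))))

sum₃-+ : ∀ n f g → sum₃ n (λ k → f k +₃ g k) ≡ sum₃ n f +₃ sum₃ n g
sum₃-+ zero    f g = refl
sum₃-+ (suc n) f g = trans (cong (_+₃ (f (suc n) +₃ g (suc n))) (sum₃-+ n f g))
  (solve 4 (λ a b c d → (a :+ b) :+ (c :+ d) := (a :+ c) :+ (b :+ d)) refl
    (sum₃ n f) (sum₃ n g) (f (suc n)) (g (suc n)))
  where open ℚ[√-3]-Solver

sum₃-*ˡ : ∀ n c f → sum₃ n (λ k → c *₃ f k) ≡ c *₃ sum₃ n f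
sum₃-*ˡ zero    c f = refl
sum₃-*ˡ (suc n) c f = trans (cong (_+₃ (c *₃ f (suc n))) (sum₃-*ˡ n c f))
  (sym (*₃-distribˡ c (sum₃ n f) (f (suc n))))

sum₃-cong : ∀ n {f g} → (∀ k → k ≤ n → f k ≡ g k) → sum₃ n f ≡ sum₃ n g
sum₃-cong zero    eq = eq 0 z≤n
sum₃-cong (suc n) eq =
  cong₂ _+₃_ (sum₃-cong n (λ k k≤n → eq k (ℕP.m≤n⇒m≤1+n k≤n))) (eq (suc n) ℕP.≤-refl)

ι-sumQ : ∀ n f → ι (sumQ n f) ≡ sum₃ n (ι ∘ f)
ι-sumQ zero    f = refl
ι-sumQ (suc n) f = trans (ι-+ (sumQ n f) (f (suc n))) (cong (_+₃ ι (f (suc n))) (ι-sumQ n f))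

[1+k]*[1+n]C[1+k]≡[1+n]*nCk : ∀ n k → suc k * (suc n C suc k) ≡ suc n * (n C k)
[1+k]*[1+n]C[1+k]≡[1+n]*nCk zero zero = refl
[1+k]*[1+n]C[1+k]≡[1+n]*nCk zero (suc k)
  rewrite k>n⇒nCk≡0 {1} {suc (suc k)} (s≤s (s≤s z≤n)) | k>n⇒nCk≡0 {0} {suc k} (s≤s z≤n)
  = ℕP.*-zeroʳ (suc (suc k))
[1+k]*[1+n]C[1+k]≡[1+n]*nCk (suc n) zero =
  trans (ℕP.*-identityˡ (suc (suc n) C 1)) (trans (nC1≡n (suc (suc n))) (sym (ℕP.*-identityʳ (suc (suc n)))))
[1+k]*[1+n]C[1+k]≡[1+n]*nCk (suc n) (suc k) = begin
  (2 + k) * ((2 + n) C (2 + k))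
    ≡⟨ cong ((2 + k) *_) (nCk+nC[k+1]≡[n+1]C[k+1] (suc n) (suc k)) ⟨
  (2 + k) * (c + d)
    ≡⟨ solve 3 (λ k c d → (con 2 :+ k) :* (c :+ d) := (con 1 :+ k) :* c :+ c :+ (con 2 :+ k) :* d) refl k c d ⟩
  (1 + k) * c + c + (2 + k) * d
    ≡⟨ cong₂ (λ u v → u + c + v) ([1+k]*[1+n]C[1+k]≡[1+n]*nCk n k) ([1+k]*[1+n]C[1+k]≡[1+n]*nCk n (suc k)) ⟩
  (1 + n) * (n C k) + c + (1 + n) * (n C suc k)
    ≡⟨ solve 4 (λ n a b c → (con 1 :+ n) :* a :+ c :+ (con 1 :+ n) :* b := (con 1 :+ n) :* (a :+ b) :+ c) refl n (n C k) (n C suc k) c ⟩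
  (1 + n) * (n C k + n C suc k) + c
    ≡⟨ cong (λ z → (1 + n) * z + c) (nCk+nC[k+1]≡[n+1]C[k+1] n k) ⟩
  (1 + n) * c + c
    ≡⟨ solve 2 (λ n c → (con 1 :+ n) :* c :+ c := (con 2 :+ n) :* c) refl n c ⟩
  (2 + n) * c
    ∎
  where open ≡-Reasoning
        open ℕSolver.+-*-Solver
        c d : ℕ
        c = suc n C suc k
        d = suc n C suc (suc k)

-- Exponential generating functions over ℚ(√-3)

Series : Set
Series = ℕ → Q3

infix 4 _≋_
_≋_ : Series → Series → Set
f ≋ g = ∀ n → f n ≡ g n

≋-isEquivalence : IsEquivalence _≋_
≋-isEquivalence = record
  { refl = λ n → refl ; sym = λ f≋g n → sym (f≋g n) ; trans = λ f≋g g≋h n → trans (f≋g n) (g≋h n) }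

open IsEquivalence ≋-isEquivalence public
  using () renaming (refl to ≋-refl; sym to ≋-sym; trans to ≋-trans)

infixl 6 _+ₛ_ _-ₛ_
infixl 7 _*ₛ_ _·ₛ_
infix  8 -ₛ_

tail : Series → Series
tail f = f ∘ suc

_+ₛ_ : Series → Series → Series
(f +ₛ g) n = f n +₃ g n

-ₛ_ : Series → Series
(-ₛ f) n = -₃ f n

_-ₛ_ : Series → Series → Series
f -ₛ g = f +ₛ (-ₛ g)

_·ₛ_ : Q3 → Series → Series
(c ·ₛ f) n = c *₃ f n

0ₛ : Series
0ₛ _ = 0₃

const : Q3 → Series
const c zero    = c
const c (suc _) = 0₃

1ₛ : Series
1ₛ = const 1₃

-- Since tail is differentiation of exponential generating functions, the
-- product rule (f g)' = f' g + f g' determines the product coefficientwise.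
_*ₛ_ : Series → Series → Series
(f *ₛ g) zero    = f 0 *₃ g 0
(f *ₛ g) (suc n) = (tail f *ₛ g) n +₃ (f *ₛ tail g) n

+ₛ-cong : ∀ {f f′ g g′} → f ≋ f′ → g ≋ g′ → f +ₛ g ≋ f′ +ₛ g′
+ₛ-cong f≋f′ g≋g′ n = cong₂ _+₃_ (f≋f′ n) (g≋g′ n)

-ₛ-cong : ∀ {f g} → f ≋ g → -ₛ f ≋ -ₛ g
-ₛ-cong f≋g n = cong (λ x → -₃ x) (f≋g n)

*ₛ-cong : ∀ {f f′ g g′} → f ≋ f′ → g ≋ g′ → f *ₛ g ≋ f′ *ₛ g′
*ₛ-cong f≋f′ g≋g′ zero    = cong₂ _*₃_ (f≋f′ 0) (g≋g′ 0)
*ₛ-cong f≋f′ g≋g′ (suc n) = cong₂ _+₃_ (*ₛ-cong (f≋f′ ∘ suc) g≋g′ n) (*ₛ-cong f≋f′ (g≋g′ ∘ suc) n)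

*ₛ-comm : ∀ f g → f *ₛ g ≋ g *ₛ f
*ₛ-comm f g zero    = *₃-comm (f 0) (g 0)
*ₛ-comm f g (suc n) = trans (cong₂ _+₃_ (*ₛ-comm (tail f) g n) (*ₛ-comm f (tail g) n))
  (+₃-comm ((g *ₛ tail f) n) ((tail g *ₛ f) n))

*ₛ-distribʳ : ∀ h f g → (f +ₛ g) *ₛ h ≋ f *ₛ h +ₛ g *ₛ h
*ₛ-distribʳ h f g zero    = *₃-distribʳ (h 0) (f 0) (g 0)
*ₛ-distribʳ h f g (suc n) =
  trans (cong₂ _+₃_ (*ₛ-distribʳ h (tail f) (tail g) n) (*ₛ-distribʳ (tail h) f g n))
    (solve 4 (λ a b c d → (a :+ b) :+ (c :+ d) := (a :+ c) :+ (b :+ d)) refl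
      ((tail f *ₛ h) n) ((tail g *ₛ h) n) ((f *ₛ tail h) n) ((g *ₛ tail h) n))
  where open ℚ[√-3]-Solver

*ₛ-distribˡ : ∀ f g h → f *ₛ (g +ₛ h) ≋ f *ₛ g +ₛ f *ₛ h
*ₛ-distribˡ f g h n = trans (*ₛ-comm f (g +ₛ h) n)
  (trans (*ₛ-distribʳ f g h n) (cong₂ _+₃_ (*ₛ-comm g f n) (*ₛ-comm h f n)))

·ₛ-*ₛ-assoc : ∀ c f g → (c ·ₛ f) *ₛ g ≋ c ·ₛ (f *ₛ g)
·ₛ-*ₛ-assoc c f g zero    = *₃-assoc c (f 0) (g 0)
·ₛ-*ₛ-assoc c f g (suc n) =
  trans (cong₂ _+₃_ (·ₛ-*ₛ-assoc c (tail f) g n) (·ₛ-*ₛ-assoc c f (tail g) n))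
    (sym (*₃-distribˡ c ((tail f *ₛ g) n) ((f *ₛ tail g) n)))

*ₛ-·ₛ-comm : ∀ c f g → f *ₛ (c ·ₛ g) ≋ c ·ₛ (f *ₛ g)
*ₛ-·ₛ-comm c f g n =
  trans (*ₛ-comm f (c ·ₛ g) n) (trans (·ₛ-*ₛ-assoc c g f n) (cong (c *₃_) (*ₛ-comm g f n)))

*ₛ-zeroˡ : ∀ g → 0ₛ *ₛ g ≋ 0ₛ
*ₛ-zeroˡ g zero    = solve 1 (λ x → con 0₃ :* x := con 0₃) refl (g 0)
  where open ℚ[√-3]-Solver
*ₛ-zeroˡ g (suc n) = trans (cong₂ _+₃_ (*ₛ-zeroˡ g n) (*ₛ-zeroˡ (tail g) n)) (+₃-identityˡ 0₃)

const-*ₛ : ∀ c f → const c *ₛ f ≋ c ·ₛ f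
const-*ₛ c f zero    = refl
const-*ₛ c f (suc n) =
  trans (cong₂ _+₃_ (*ₛ-zeroˡ f n) (const-*ₛ c (tail f) n)) (+₃-identityˡ (c *₃ f (suc n)))

*ₛ-identityˡ : ∀ f → 1ₛ *ₛ f ≋ f
*ₛ-identityˡ f n = trans (const-*ₛ 1₃ f n) (*₃-identityˡ (f n))

*ₛ-identityʳ : ∀ f → f *ₛ 1ₛ ≋ f
*ₛ-identityʳ f n = trans (*ₛ-comm f 1ₛ n) (*ₛ-identityˡ f n)

*ₛ-assoc : ∀ f g h → (f *ₛ g) *ₛ h ≋ f *ₛ (g *ₛ h)
*ₛ-assoc f g h zero    = *₃-assoc (f 0) (g 0) (h 0)
*ₛ-assoc f g h (suc n) = begin
  ((tail f *ₛ g +ₛ f *ₛ tail g) *ₛ h) n +₃ ((f *ₛ g) *ₛ tail h) n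
    ≡⟨ cong (_+₃ ((f *ₛ g) *ₛ tail h) n) (*ₛ-distribʳ h (tail f *ₛ g) (f *ₛ tail g) n) ⟩
  (((tail f *ₛ g) *ₛ h) n +₃ ((f *ₛ tail g) *ₛ h) n) +₃ ((f *ₛ g) *ₛ tail h) n
    ≡⟨ cong₂ _+₃_ (cong₂ _+₃_ (*ₛ-assoc (tail f) g h n) (*ₛ-assoc f (tail g) h n)) (*ₛ-assoc f g (tail h) n) ⟩
  ((tail f *ₛ (g *ₛ h)) n +₃ (f *ₛ (tail g *ₛ h)) n) +₃ (f *ₛ (g *ₛ tail h)) n
    ≡⟨ +₃-assoc ((tail f *ₛ (g *ₛ h)) n) ((f *ₛ (tail g *ₛ h)) n) ((f *ₛ (g *ₛ tail h)) n) ⟩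
  (tail f *ₛ (g *ₛ h)) n +₃ ((f *ₛ (tail g *ₛ h)) n +₃ (f *ₛ (g *ₛ tail h)) n)
    ≡⟨ cong ((tail f *ₛ (g *ₛ h)) n +₃_) (*ₛ-distribˡ f (tail g *ₛ h) (g *ₛ tail h) n) ⟨
  (tail f *ₛ (g *ₛ h)) n +₃ (f *ₛ (tail g *ₛ h +ₛ g *ₛ tail h)) n
    ∎
  where open ≡-Reasoning

ℚ[√-3][[x]]-isCommutativeRing : IsCommutativeRing _≋_ _+ₛ_ _*ₛ_ -ₛ_ 0ₛ 1ₛ
ℚ[√-3][[x]]-isCommutativeRing = record
  { isRing = record
    { +-isAbelianGroup = record
      { isGroup = record
        { isMonoid = record
          { isSemigroup = record
            { isMagma = record
              { isEquivalence = ≋-isEquivalence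
              ; ∙-cong = +ₛ-cong }
            ; assoc = λ f g h n → +₃-assoc (f n) (g n) (h n) }
          ; identity = (λ f n → +₃-identityˡ (f n)) , (λ f n → +₃-identityʳ (f n)) }
        ; inverse = (λ f n → -₃-inverseˡ (f n)) , (λ f n → -₃-inverseʳ (f n))
        ; ⁻¹-cong = -ₛ-cong }
      ; comm = λ f g n → +₃-comm (f n) (g n) }
    ; *-cong = *ₛ-cong
    ; *-assoc = *ₛ-assoc
    ; *-identity = *ₛ-identityˡ , *ₛ-identityʳ
    ; distrib = *ₛ-distribˡ , *ₛ-distribʳ }
  ; *-comm = *ₛ-comm }

ℚ[√-3][[x]] : CommutativeRing _ _
ℚ[√-3][[x]] = record { isCommutativeRing = ℚ[√-3][[x]]-isCommutativeRing }

module ≋-Reasoning = SetoidReasoning (CommutativeRing.setoid ℚ[√-3][[x]])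

const-+ : ∀ a b → const (a +₃ b) ≋ const a +ₛ const b
const-+ a b zero    = refl
const-+ a b (suc n) = sym (+₃-identityˡ 0₃)

const-* : ∀ a b → const (a *₃ b) ≋ const a *ₛ const b
const-* a b n = sym (trans (const-*ₛ a (const b) n) (lemma n))
  where lemma : ∀ n → a *₃ const b n ≡ const (a *₃ b) n
        lemma zero    = refl
        lemma (suc n) = solve 1 (λ a → a :* con 0₃ := con 0₃) refl a
          where open ℚ[√-3]-Solver

const-homomorphism : ACR._-Raw-AlmostCommutative⟶_
  (CommutativeRing.rawRing ℚ[√-3]) (ACR.fromCommutativeRing ℚ[√-3][[x]])
const-homomorphism = record
  { ⟦_⟧    = const
  ; +-homo = const-+
  ; *-homo = const-*
  ; -‿homo = λ { a zero → refl ; a (suc n) → refl }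
  ; 0-homo = λ { zero → refl ; (suc n) → refl }
  ; 1-homo = λ { zero → refl ; (suc n) → refl } }

const-≟ : ∀ a b → Maybe (const a ≋ const b)
const-≟ a b with a ≟₃ b
... | yes refl = just (λ n → refl)
... | no _     = nothing

module Series-Solver = RingSolver (CommutativeRing.rawRing ℚ[√-3])
  (ACR.fromCommutativeRing ℚ[√-3][[x]]) const-homomorphism const-≟

binomialTerm : Series → Series → ℕ → ℕ → ℕ → Q3
binomialTerm f g n m k = ιℕ (n C k) *₃ (f k *₃ g (m ∸ k))

egf*₃-tailʳ : ∀ n f g → sum₃ (suc n) (binomialTerm f g n (suc n)) ≡ egf*₃ f (tail g) n
egf*₃-tailʳ n f g = begin
  sum₃ n (binomialTerm f g n (suc n)) +₃ binomialTerm f g n (suc n) (suc n)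
    ≡⟨ cong (λ c → sum₃ n (binomialTerm f g n (suc n)) +₃ ιℕ c *₃ (f (suc n) *₃ g (n ∸ n)))
         (k>n⇒nCk≡0 (ℕP.n<1+n n)) ⟩
  sum₃ n (binomialTerm f g n (suc n)) +₃ 0₃ *₃ (f (suc n) *₃ g (n ∸ n))
    ≡⟨ solve 2 (λ s t → s :+ con 0₃ :* t := s) refl _ (f (suc n) *₃ g (n ∸ n)) ⟩
  sum₃ n (binomialTerm f g n (suc n))
    ≡⟨ sum₃-cong n (λ k k≤n → cong (λ m → ιℕ (n C k) *₃ (f k *₃ g m)) (ℕP.+-∸-assoc 1 k≤n)) ⟩
  egf*₃ f (tail g) n
    ∎
  where open ≡-Reasoning
        open ℚ[√-3]-Solver

ιℕ-pascal : ∀ n k → ιℕ (suc n C suc k) ≡ ιℕ (n C k) +₃ ιℕ (n C suc k)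
ιℕ-pascal n k = trans (cong ιℕ (sym (nCk+nC[k+1]≡[n+1]C[k+1] n k))) (ιℕ-+ (n C k) (n C suc k))

egf*₃-suc : ∀ n f g → egf*₃ f g (suc n) ≡ egf*₃ (tail f) g n +₃ egf*₃ f (tail g) n
egf*₃-suc n f g = begin
  sum₃ (suc n) (binomialTerm f g (suc n) (suc n))
    ≡⟨ sum₃-suc n (binomialTerm f g (suc n) (suc n)) ⟩
  t₀ +₃ sum₃ n (λ k → ιℕ (suc n C suc k) *₃ y k)
    ≡⟨ cong (t₀ +₃_) (sum₃-cong n (λ k _ →
         trans (cong (_*₃ y k) (ιℕ-pascal n k)) (*₃-distribʳ (y k) (ιℕ (n C k)) (ιℕ (n C suc k))))) ⟩
  t₀ +₃ sum₃ n (λ k → ιℕ (n C k) *₃ y k +₃ ιℕ (n C suc k) *₃ y k)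
    ≡⟨ cong (t₀ +₃_) (sum₃-+ n (λ k → ιℕ (n C k) *₃ y k) (λ k → ιℕ (n C suc k) *₃ y k)) ⟩
  t₀ +₃ (egf*₃ (tail f) g n +₃ s)
    ≡⟨ solve 3 (λ a p q → a :+ (p :+ q) := p :+ (a :+ q)) refl t₀ (egf*₃ (tail f) g n) s ⟩
  egf*₃ (tail f) g n +₃ (t₀ +₃ s)
    ≡⟨ cong (egf*₃ (tail f) g n +₃_) (sum₃-suc n (binomialTerm f g n (suc n))) ⟨
  egf*₃ (tail f) g n +₃ sum₃ (suc n) (binomialTerm f g n (suc n))
    ≡⟨ cong (egf*₃ (tail f) g n +₃_) (egf*₃-tailʳ n f g) ⟩
  egf*₃ (tail f) g n +₃ egf*₃ f (tail g) n
    ∎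
  where open ≡-Reasoning
        open ℚ[√-3]-Solver
        t₀ s : Q3
        t₀ = binomialTerm f g n (suc n) 0
        y : ℕ → Q3
        y k = f (suc k) *₃ g (n ∸ k)
        s = sum₃ n (λ k → ιℕ (n C suc k) *₃ y k)

egf*₃≗*ₛ : ∀ f g → egf*₃ f g ≋ f *ₛ g
egf*₃≗*ₛ f g zero    = *₃-identityˡ (f 0 *₃ g 0)
egf*₃≗*ₛ f g (suc n) =
  trans (egf*₃-suc n f g) (cong₂ _+₃_ (egf*₃≗*ₛ (tail f) g n) (egf*₃≗*ₛ f (tail g) n))

ιₛ : (ℕ → ℚ) → Series
ιₛ f = ι ∘ f

ι-egf*Q : ∀ f g n → ι (egf*Q f g n) ≡ egf*₃ (ιₛ f) (ιₛ g) n
ι-egf*Q f g n = trans (ι-sumQ n _) (sum₃-cong n (λ k _ →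
  trans (ι-* (fromℕ (n C k)) (f k ℚ.* g (n ∸ k))) (cong (ιℕ (n C k) *₃_) (ι-* (f k) (g (n ∸ k))))))

-- f(x) ↦ f(ax)
scale : Q3 → Series → Series
scale a f n = (a ^₃ n) *₃ f n

scale-cong : ∀ a {f g} → f ≋ g → scale a f ≋ scale a g
scale-cong a f≋g n = cong ((a ^₃ n) *₃_) (f≋g n)

scale-+ₛ : ∀ a f g → scale a (f +ₛ g) ≋ scale a f +ₛ scale a g
scale-+ₛ a f g n = *₃-distribˡ (a ^₃ n) (f n) (g n)

scale--ₛ : ∀ a f → scale a (-ₛ f) ≋ -ₛ scale a f
scale--ₛ a f n = solve 2 (λ p x → p :* (:- x) := :- (p :* x)) refl (a ^₃ n) (f n)
  where open ℚ[√-3]-Solver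

scale-const : ∀ a c → scale a (const c) ≋ const c
scale-const a c zero    = *₃-identityˡ c
scale-const a c (suc n) = solve 1 (λ p → p :* con 0₃ := con 0₃) refl (a ^₃ suc n)
  where open ℚ[√-3]-Solver

scale-*ₛ : ∀ a f g → scale a (f *ₛ g) ≋ scale a f *ₛ scale a g
scale-*ₛ a f g zero    = sym (solve 2 (λ x y → (con 1₃ :* x) :* (con 1₃ :* y) := con 1₃ :* (x :* y)) refl (f 0) (g 0))
  where open ℚ[√-3]-Solver
scale-*ₛ a f g (suc n) = sym (begin
  (tail (scale a f) *ₛ scale a g) n +₃ (scale a f *ₛ tail (scale a g)) n
    ≡⟨ cong₂ _+₃_ (*ₛ-cong (λ k → *₃-assoc a (a ^₃ k) (f (suc k))) (λ _ → refl) n)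
      (*ₛ-cong (λ _ → refl) (λ k → *₃-assoc a (a ^₃ k) (g (suc k))) n) ⟩
  (a ·ₛ scale a (tail f) *ₛ scale a g) n +₃ (scale a f *ₛ (a ·ₛ scale a (tail g))) n
    ≡⟨ cong₂ _+₃_ (·ₛ-*ₛ-assoc a (scale a (tail f)) (scale a g) n) (*ₛ-·ₛ-comm a (scale a f) (scale a (tail g)) n) ⟩
  a *₃ (scale a (tail f) *ₛ scale a g) n +₃ a *₃ (scale a f *ₛ scale a (tail g)) n
    ≡⟨ cong₂ (λ u v → a *₃ u +₃ a *₃ v) (scale-*ₛ a (tail f) g n) (scale-*ₛ a f (tail g) n) ⟨
  a *₃ ((a ^₃ n) *₃ (tail f *ₛ g) n) +₃ a *₃ ((a ^₃ n) *₃ (f *ₛ tail g) n)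
    ≡⟨ solve 4 (λ a p u v → a :* (p :* u) :+ a :* (p :* v) := (a :* p) :* (u :+ v)) refl
      a (a ^₃ n) ((tail f *ₛ g) n) ((f *ₛ tail g) n) ⟩
  (a ^₃ suc n) *₃ (f *ₛ g) (suc n)
    ∎)
  where open ≡-Reasoning
        open ℚ[√-3]-Solver

exp : Q3 → Series
exp a n = a ^₃ n

exp-+ : ∀ a b → exp a *ₛ exp b ≋ exp (a +₃ b)
exp-+ a b zero    = *₃-identityˡ 1₃
exp-+ a b (suc n) = begin
  (a ·ₛ exp a *ₛ exp b) n +₃ (exp a *ₛ (b ·ₛ exp b)) n
    ≡⟨ cong₂ _+₃_ (·ₛ-*ₛ-assoc a (exp a) (exp b) n) (*ₛ-·ₛ-comm b (exp a) (exp b) n) ⟩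
  a *₃ (exp a *ₛ exp b) n +₃ b *₃ (exp a *ₛ exp b) n
    ≡⟨ cong (λ z → a *₃ z +₃ b *₃ z) (exp-+ a b n) ⟩
  a *₃ ((a +₃ b) ^₃ n) +₃ b *₃ ((a +₃ b) ^₃ n)
    ≡⟨ *₃-distribʳ ((a +₃ b) ^₃ n) a b ⟨
  (a +₃ b) ^₃ suc n
    ∎
  where open ≡-Reasoning

exp-0 : exp 0₃ ≋ 1ₛ
exp-0 zero    = refl
exp-0 (suc n) = solve 1 (λ x → con 0₃ :* x := con 0₃) refl (0₃ ^₃ n)
  where open ℚ[√-3]-Solver

eˣ : Series
eˣ _ = 1₃

eˣ≋exp1 : eˣ ≋ exp 1₃
eˣ≋exp1 zero    = refl
eˣ≋exp1 (suc n) = sym (trans (*₃-identityˡ (1₃ ^₃ n)) (sym (eˣ≋exp1 n)))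

scale-eˣ : ∀ a → scale a eˣ ≋ exp a
scale-eˣ a n = *₃-identityʳ (a ^₃ n)

X : Series
X zero    = 0₃
X (suc n) = 1ₛ n

X*ₛ-zero : ∀ f → (X *ₛ f) 0 ≡ 0₃
X*ₛ-zero f = *ₛ-zeroˡ f 0

X*ₛ-suc : ∀ f n → (X *ₛ f) (suc n) ≡ ιℕ (suc n) *₃ f n
X*ₛ-suc f zero    = trans (cong₂ _+₃_ (*ₛ-identityˡ f 0) (X*ₛ-zero (tail f)))
  (trans (+₃-identityʳ (f 0)) (sym (*₃-identityˡ (f 0))))
X*ₛ-suc f (suc n) = begin
  (1ₛ *ₛ f) (suc n) +₃ (X *ₛ tail f) (suc n)
    ≡⟨ cong₂ _+₃_ (*ₛ-identityˡ f (suc n)) (X*ₛ-suc (tail f) n) ⟩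
  f (suc n) +₃ ιℕ (suc n) *₃ f (suc n)
    ≡⟨ solve 2 (λ c x → x :+ c :* x := (con 1₃ :+ c) :* x) refl (ιℕ (suc n)) (f (suc n)) ⟩
  (1₃ +₃ ιℕ (suc n)) *₃ f (suc n)
    ≡⟨ cong (_*₃ f (suc n)) (ιℕ-+ 1 (suc n)) ⟨
  ιℕ (suc (suc n)) *₃ f (suc n)
    ∎
  where open ≡-Reasoning
        open ℚ[√-3]-Solver

X*ₛ-cancelˡ : ∀ {f g} → X *ₛ f ≋ X *ₛ g → f ≋ g
X*ₛ-cancelˡ {f} {g} eq n =
  *-cancelˡ-ιℕ[1+n] n (trans (sym (X*ₛ-suc f n)) (trans (eq (suc n)) (X*ₛ-suc g n)))

scale-X : ∀ a → scale a X ≋ const a *ₛ X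
scale-X a n = trans (lemma n) (sym (const-*ₛ a X n))
  where open ℚ[√-3]-Solver
        lemma : ∀ n → scale a X n ≡ a *₃ X n
        lemma zero          = solve 1 (λ a → con 1₃ :* con 0₃ := a :* con 0₃) refl a
        lemma (suc zero)    = solve 1 (λ a → (a :* con 1₃) :* con 1₃ := a :* con 1₃) refl a
        lemma (suc (suc n)) = solve 2 (λ p a → p :* con 0₃ := a :* con 0₃) refl (a ^₃ suc (suc n)) a

-- Identities between the series eˣ, (eˣ - 1)/x and e²ˣ + eˣ + 1

[eˣ-1]/x : Series
[eˣ-1]/x = ιₛ eˣ-1/x

X*[eˣ-1]/x≋eˣ-1 : X *ₛ [eˣ-1]/x ≋ eˣ -ₛ 1ₛ
X*[eˣ-1]/x≋eˣ-1 zero    = X*ₛ-zero [eˣ-1]/x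
X*[eˣ-1]/x≋eˣ-1 (suc n) = trans (X*ₛ-suc [eˣ-1]/x n)
  (trans (*₃-comm (ιℕ (suc n)) (ι ((+ 1) / suc n)))
    (trans (sym (ι-* ((+ 1) / suc n) (fromℕ (suc n)))) (cong ι (1/[1+n]*[1+n]≡1 n))))

ceˣ-1≋ : ∀ c → ceˣ-1 c ≋ const c *ₛ eˣ -ₛ 1ₛ
ceˣ-1≋ c zero    = solve 1 (λ c → c :- con 1₃ := c :* con 1₃ :- con 1₃) refl c
  where open ℚ[√-3]-Solver
ceˣ-1≋ c (suc n) = trans (solve 1 (λ c → c := c :* con 1₃ :- con 0₃) refl c)
  (cong (_-₃ 0₃) (sym (const-*ₛ c eˣ (suc n))))
  where open ℚ[√-3]-Solver

e²ˣ+eˣ+1 : Series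
e²ˣ+eˣ+1 = eˣ *ₛ eˣ +ₛ eˣ +ₛ 1ₛ

-- η³ = 1 and η + η² = -1 are checked by the solver on the constants.
[ηeˣ-1]*[η²eˣ-1]≋e²ˣ+eˣ+1 : ceˣ-1 (η ^₃ 1) *ₛ ceˣ-1 (η ^₃ 2) ≋ e²ˣ+eˣ+1
[ηeˣ-1]*[η²eˣ-1]≋e²ˣ+eˣ+1 n = trans (*ₛ-cong (ceˣ-1≋ (η ^₃ 1)) (ceˣ-1≋ (η ^₃ 2)) n)
  (solve 1 (λ e → (con (η ^₃ 1) :* e :- con 1₃) :* (con (η ^₃ 2) :* e :- con 1₃) := e :* e :+ e :+ con 1₃)
    ≋-refl eˣ n)
  where open Series-Solver

e³ˣ-1 : Series
e³ˣ-1 = exp (ιℕ 3) -ₛ 1ₛ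

[e²ˣ+eˣ+1]*[eˣ-1]≋e³ˣ-1 : e²ˣ+eˣ+1 *ₛ (eˣ -ₛ 1ₛ) ≋ e³ˣ-1
[e²ˣ+eˣ+1]*[eˣ-1]≋e³ˣ-1 = begin
  e²ˣ+eˣ+1 *ₛ (eˣ -ₛ 1ₛ)
    ≈⟨ solve 1 (λ e → (e :* e :+ e :+ con 1₃) :* (e :- con 1₃) := e :* e :* e :- con 1₃) ≋-refl eˣ ⟩
  eˣ *ₛ eˣ *ₛ eˣ -ₛ 1ₛ
    ≈⟨ +ₛ-cong (*ₛ-cong (*ₛ-cong eˣ≋exp1 eˣ≋exp1) eˣ≋exp1) ≋-refl ⟩
  exp 1₃ *ₛ exp 1₃ *ₛ exp 1₃ -ₛ 1ₛ
    ≈⟨ +ₛ-cong (≋-trans (*ₛ-cong (exp-+ 1₃ 1₃) ≋-refl) (exp-+ (1₃ +₃ 1₃) 1₃)) ≋-refl ⟩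
  e³ˣ-1
    ∎
  where open Series-Solver
        open ≋-Reasoning

[e³ˣ-1]/3x : Series
[e³ˣ-1]/3x = scale (ιℕ 3) [eˣ-1]/x

3*X*[e³ˣ-1]/3x≋e³ˣ-1 : const (ιℕ 3) *ₛ (X *ₛ [e³ˣ-1]/3x) ≋ e³ˣ-1
3*X*[e³ˣ-1]/3x≋e³ˣ-1 = begin
  const (ιℕ 3) *ₛ (X *ₛ [e³ˣ-1]/3x)
    ≈⟨ *ₛ-assoc (const (ιℕ 3)) X [e³ˣ-1]/3x ⟨
  const (ιℕ 3) *ₛ X *ₛ [e³ˣ-1]/3x
    ≈⟨ *ₛ-cong (scale-X (ιℕ 3)) ≋-refl ⟨
  scale (ιℕ 3) X *ₛ [e³ˣ-1]/3x
    ≈⟨ scale-*ₛ (ιℕ 3) X [eˣ-1]/x ⟨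
  scale (ιℕ 3) (X *ₛ [eˣ-1]/x)
    ≈⟨ scale-cong (ιℕ 3) X*[eˣ-1]/x≋eˣ-1 ⟩
  scale (ιℕ 3) (eˣ -ₛ 1ₛ)
    ≈⟨ scale-+ₛ (ιℕ 3) eˣ (-ₛ 1ₛ) ⟩
  scale (ιℕ 3) eˣ +ₛ scale (ιℕ 3) (-ₛ 1ₛ)
    ≈⟨ +ₛ-cong (scale-eˣ (ιℕ 3))
      (≋-trans (scale--ₛ (ιℕ 3) 1ₛ) (-ₛ-cong (scale-const (ιℕ 3) 1₃))) ⟩
  e³ˣ-1
    ∎
  where open ≋-Reasoning

[e²ˣ+eˣ+1]*[eˣ-1]/x≋3*[e³ˣ-1]/3x : e²ˣ+eˣ+1 *ₛ [eˣ-1]/x ≋ const (ιℕ 3) *ₛ [e³ˣ-1]/3x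
[e²ˣ+eˣ+1]*[eˣ-1]/x≋3*[e³ˣ-1]/3x = X*ₛ-cancelˡ (begin
  X *ₛ (e²ˣ+eˣ+1 *ₛ [eˣ-1]/x)
    ≈⟨ solve 3 (λ x n d → x :* (n :* d) := n :* (x :* d)) ≋-refl X e²ˣ+eˣ+1 [eˣ-1]/x ⟩
  e²ˣ+eˣ+1 *ₛ (X *ₛ [eˣ-1]/x)
    ≈⟨ *ₛ-cong ≋-refl X*[eˣ-1]/x≋eˣ-1 ⟩
  e²ˣ+eˣ+1 *ₛ (eˣ -ₛ 1ₛ)
    ≈⟨ [e²ˣ+eˣ+1]*[eˣ-1]≋e³ˣ-1 ⟩
  e³ˣ-1
    ≈⟨ 3*X*[e³ˣ-1]/3x≋e³ˣ-1 ⟨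
  const (ιℕ 3) *ₛ (X *ₛ [e³ˣ-1]/3x)
    ≈⟨ solve 2 (λ x d → con (ιℕ 3) :* (x :* d) := x :* (con (ιℕ 3) :* d)) ≋-refl X [e³ˣ-1]/3x ⟩
  X *ₛ (const (ιℕ 3) *ₛ [e³ˣ-1]/3x)
    ∎)
  where open ≋-Reasoning
        open Series-Solver

X*eˣ[eˣ-1]/x≋e²ˣ-eˣ : X *ₛ (eˣ *ₛ [eˣ-1]/x) ≋ eˣ *ₛ eˣ -ₛ eˣ
X*eˣ[eˣ-1]/x≋e²ˣ-eˣ = begin
  X *ₛ (eˣ *ₛ [eˣ-1]/x)   ≈⟨ solve 3 (λ x e d → x :* (e :* d) := e :* (x :* d)) ≋-refl X eˣ [eˣ-1]/x ⟩
  eˣ *ₛ (X *ₛ [eˣ-1]/x)   ≈⟨ *ₛ-cong ≋-refl X*[eˣ-1]/x≋eˣ-1 ⟩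
  eˣ *ₛ (eˣ -ₛ 1ₛ)        ≈⟨ solve 1 (λ e → e :* (e :- con 1₃) := e :* e :- e) ≋-refl eˣ ⟩
  eˣ *ₛ eˣ -ₛ eˣ          ∎
  where open ≋-Reasoning
        open Series-Solver

ιℕ[2^[j+1]∸1]≡[1+j]*[eˣ*[eˣ-1]/x]ⱼ : ∀ j → ιℕ (2 ^ (j + 1) ∸ 1) ≡ ιℕ (suc j) *₃ (eˣ *ₛ [eˣ-1]/x) j
ιℕ[2^[j+1]∸1]≡[1+j]*[eˣ*[eˣ-1]/x]ⱼ j = begin
  ιℕ (2 ^ (j + 1) ∸ 1)
    ≡⟨ cong (λ k → ιℕ (2 ^ k ∸ 1)) (ℕP.+-comm j 1) ⟩
  ιℕ (2 ^ suc j ∸ 1)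
    ≡⟨ ιℕ-∸1 (ℕP.m^n>0 2 (suc j)) ⟩
  ιℕ (2 ^ suc j) -₃ 1₃
    ≡⟨ cong (_-₃ 1₃) (ιℕ-^ 2 (suc j)) ⟩
  exp (ιℕ 2) (suc j) -₃ 1₃
    ≡⟨ cong (_-₃ 1₃) (trans (*ₛ-cong eˣ≋exp1 eˣ≋exp1 (suc j)) (exp-+ 1₃ 1₃ (suc j))) ⟨
  (eˣ *ₛ eˣ -ₛ eˣ) (suc j)
    ≡⟨ X*eˣ[eˣ-1]/x≋e²ˣ-eˣ (suc j) ⟨
  (X *ₛ (eˣ *ₛ [eˣ-1]/x)) (suc j)
    ≡⟨ X*ₛ-suc (eˣ *ₛ [eˣ-1]/x) j ⟩
  ιℕ (suc j) *₃ (eˣ *ₛ [eˣ-1]/x) j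
    ∎
  where open ≡-Reasoning

one₃≋1ₛ : one₃ ≋ 1ₛ
one₃≋1ₛ zero    = refl
one₃≋1ₛ (suc n) = refl

*ₛ-inverse-unique : ∀ {c f g} → c *ₛ f ≋ 1ₛ → c *ₛ g ≋ 1ₛ → f ≋ g
*ₛ-inverse-unique {c} {f} {g} cf≋1 cg≋1 = begin
  f                ≈⟨ solve 1 (λ f → f := f :* con 1₃) ≋-refl f ⟩
  f *ₛ 1ₛ          ≈⟨ *ₛ-cong ≋-refl cg≋1 ⟨
  f *ₛ (c *ₛ g)    ≈⟨ solve 3 (λ c f g → f :* (c :* g) := (c :* f) :* g) ≋-refl c f g ⟩
  c *ₛ f *ₛ g      ≈⟨ *ₛ-cong cf≋1 ≋-refl ⟩
  1ₛ *ₛ g          ≈⟨ *ₛ-identityˡ g ⟩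
  g                ∎
  where open ≋-Reasoning
        open Series-Solver

-- The sum in the formula for ω_{2n;1}, with K = 2n.
evenSum : (ℕ → ℚ) → ℕ → ℚ
evenSum B K = sumQ K (λ j → fromℕ (3 ^ (K ∸ j)) ℚ.* fromℕ (2 ^ (j + 1) ∸ 1)
                           ℚ.* fromℕ ((K + 1) C (K ∸ j)) ℚ.* B (K ∸ j))

ι-evenSum : ∀ B K → ι (evenSum B K) ≡ ιℕ (suc K) *₃ (eˣ *ₛ [eˣ-1]/x *ₛ scale (ιℕ 3) (ιₛ B)) K
ι-evenSum B K = begin
  ι (evenSum B K)
    ≡⟨ ι-sumQ K _ ⟩
  sum₃ K (λ j → ι (fromℕ (3 ^ (K ∸ j)) ℚ.* fromℕ (2 ^ (j + 1) ∸ 1) ℚ.* fromℕ ((K + 1) C (K ∸ j)) ℚ.* B (K ∸ j)))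
    ≡⟨ sum₃-cong K ι-term ⟩
  sum₃ K (λ j → ιℕ (suc K) *₃ binomialTerm e b₃ K K j)
    ≡⟨ sum₃-*ˡ K (ιℕ (suc K)) (binomialTerm e b₃ K K) ⟩
  ιℕ (suc K) *₃ egf*₃ e b₃ K
    ≡⟨ cong (ιℕ (suc K) *₃_) (egf*₃≗*ₛ e b₃ K) ⟩
  ιℕ (suc K) *₃ (e *ₛ b₃) K
    ∎
  where
  open ≡-Reasoning
  open ℚ[√-3]-Solver
  e b₃ : Series
  e  = eˣ *ₛ [eˣ-1]/x
  b₃ = scale (ιℕ 3) (ιₛ B)
  ι-term : ∀ j → j ≤ K →
    ι (fromℕ (3 ^ (K ∸ j)) ℚ.* fromℕ (2 ^ (j + 1) ∸ 1) ℚ.* fromℕ ((K + 1) C (K ∸ j)) ℚ.* B (K ∸ j))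
      ≡ ιℕ (suc K) *₃ binomialTerm e b₃ K K j
  ι-term j j≤K = begin
    ι (p ℚ.* q ℚ.* r ℚ.* B (K ∸ j))
      ≡⟨ trans (ι-* (p ℚ.* q ℚ.* r) (B (K ∸ j)))
           (cong (_*₃ β) (trans (ι-* (p ℚ.* q) r) (cong (_*₃ ι r) (ι-* p q)))) ⟩
    ι p *₃ ι q *₃ ι r *₃ β
      ≡⟨ cong₂ (λ u v → u *₃ v *₃ β) (cong₂ _*₃_ (ιℕ-^ 3 (K ∸ j)) (ιℕ[2^[j+1]∸1]≡[1+j]*[eˣ*[eˣ-1]/x]ⱼ j))
           (cong ιℕ (trans (cong (_C (K ∸ j)) (ℕP.+-comm K 1)) (sym (nCk≡nC[n∸k] (s≤s j≤K))))) ⟩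
    ιℕ 3 ^₃ (K ∸ j) *₃ (ιℕ (suc j) *₃ e j) *₃ ιℕ (suc K C suc j) *₃ β
      ≡⟨ solve 5 (λ t s ej c β → t :* (s :* ej) :* c :* β := (s :* c) :* (ej :* (t :* β))) refl
           (ιℕ 3 ^₃ (K ∸ j)) (ιℕ (suc j)) (e j) (ιℕ (suc K C suc j)) β ⟩
    (ιℕ (suc j) *₃ ιℕ (suc K C suc j)) *₃ (e j *₃ b₃ (K ∸ j))
      ≡⟨ cong (_*₃ (e j *₃ b₃ (K ∸ j))) absorption ⟩
    (ιℕ (suc K) *₃ ιℕ (K C j)) *₃ (e j *₃ b₃ (K ∸ j))
      ≡⟨ *₃-assoc (ιℕ (suc K)) (ιℕ (K C j)) (e j *₃ b₃ (K ∸ j)) ⟩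
    ιℕ (suc K) *₃ binomialTerm e b₃ K K j
      ∎
    where
    p q r : ℚ
    p = fromℕ (3 ^ (K ∸ j))
    q = fromℕ (2 ^ (j + 1) ∸ 1)
    r = fromℕ ((K + 1) C (K ∸ j))
    β : Q3
    β = ι (B (K ∸ j))
    absorption : ιℕ (suc j) *₃ ιℕ (suc K C suc j) ≡ ιℕ (suc K) *₃ ιℕ (K C j)
    absorption = trans (sym (ιℕ-* (suc j) (suc K C suc j)))
      (trans (cong ιℕ ([1+k]*[1+n]C[1+k]≡[1+n]*nCk K j)) (ιℕ-* (suc K) (K C j)))

e⁻ˣ : Series
e⁻ˣ = exp (-₃ 1₃)

eˣ*e⁻ˣ≋1 : eˣ *ₛ e⁻ˣ ≋ 1ₛ
eˣ*e⁻ˣ≋1 = ≋-trans (*ₛ-cong eˣ≋exp1 ≋-refl) (≋-trans (exp-+ 1₃ (-₃ 1₃)) exp-0)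

scale-ceˣ-1 : ∀ a c → scale a (ceˣ-1 c) ≋ const c *ₛ exp a -ₛ 1ₛ
scale-ceˣ-1 a c = begin
  scale a (ceˣ-1 c)
    ≈⟨ scale-cong a (ceˣ-1≋ c) ⟩
  scale a (const c *ₛ eˣ -ₛ 1ₛ)
    ≈⟨ scale-+ₛ a (const c *ₛ eˣ) (-ₛ 1ₛ) ⟩
  scale a (const c *ₛ eˣ) +ₛ scale a (-ₛ 1ₛ)
    ≈⟨ +ₛ-cong (≋-trans (scale-*ₛ a (const c) eˣ) (*ₛ-cong (scale-const a c) (scale-eˣ a)))
      (≋-trans (scale--ₛ a 1ₛ) (-ₛ-cong (scale-const a 1₃))) ⟩
  const c *ₛ exp a -ₛ 1ₛ
    ∎
  where open ≋-Reasoning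

double : ℕ → ℕ
double zero    = zero
double (suc n) = suc (suc (double n))

double≡2* : ∀ n → double n ≡ 2 * n
double≡2* zero    = refl
double≡2* (suc n) = cong suc (trans (cong suc (double≡2* n)) (sym (ℕP.+-suc n (n + 0))))

[-1]^double≡1 : ∀ n → (-₃ 1₃) ^₃ double n ≡ 1₃
[-1]^double≡1 zero    = refl
[-1]^double≡1 (suc n) = cong (λ x → -₃ 1₃ *₃ (-₃ 1₃ *₃ x)) ([-1]^double≡1 n)

module Omega3 (B : ℕ → ℚ) (ω₁ ω₂ : Series)
              (isB : IsBernoulli B) (isω₁ : IsOmega3 1 ω₁) (isω₂ : IsOmega3 2 ω₂) where

  x/[eˣ-1] : Series
  x/[eˣ-1] = ιₛ B

  3x/[e³ˣ-1] : Series
  3x/[e³ˣ-1] = scale (ιℕ 3) x/[eˣ-1]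

  3/[e²ˣ+eˣ+1] : Series
  3/[e²ˣ+eˣ+1] = [eˣ-1]/x *ₛ 3x/[e³ˣ-1]

  c₁ c₂ : Series
  c₁ = ceˣ-1 (η ^₃ 1)
  c₂ = ceˣ-1 (η ^₃ 2)

  c₁*ω₁≋1 : c₁ *ₛ ω₁ ≋ 1ₛ
  c₁*ω₁≋1 n = trans (sym (egf*₃≗*ₛ c₁ ω₁ n)) (trans (isω₁ n) (one₃≋1ₛ n))

  c₂*ω₂≋1 : c₂ *ₛ ω₂ ≋ 1ₛ
  c₂*ω₂≋1 n = trans (sym (egf*₃≗*ₛ c₂ ω₂ n)) (trans (isω₂ n) (one₃≋1ₛ n))

  [eˣ-1]/x*x/[eˣ-1]≋1 : [eˣ-1]/x *ₛ x/[eˣ-1] ≋ 1ₛ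
  [eˣ-1]/x*x/[eˣ-1]≋1 n = trans (sym (egf*₃≗*ₛ [eˣ-1]/x x/[eˣ-1] n))
    (trans (sym (ι-egf*Q eˣ-1/x B n)) (trans (cong ι (isB n)) (one₃≋1ₛ n)))

  [e³ˣ-1]/3x*3x/[e³ˣ-1]≋1 : [e³ˣ-1]/3x *ₛ 3x/[e³ˣ-1] ≋ 1ₛ
  [e³ˣ-1]/3x*3x/[e³ˣ-1]≋1 = begin
    [e³ˣ-1]/3x *ₛ 3x/[e³ˣ-1]         ≈⟨ scale-*ₛ (ιℕ 3) [eˣ-1]/x x/[eˣ-1] ⟨
    scale (ιℕ 3) ([eˣ-1]/x *ₛ x/[eˣ-1]) ≈⟨ scale-cong (ιℕ 3) [eˣ-1]/x*x/[eˣ-1]≋1 ⟩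
    scale (ιℕ 3) 1ₛ                  ≈⟨ scale-const (ιℕ 3) 1₃ ⟩
    1ₛ                               ∎
    where open ≋-Reasoning

  3*ω₁*ω₂≋3/[e²ˣ+eˣ+1] : const (ιℕ 3) *ₛ (ω₁ *ₛ ω₂) ≋ 3/[e²ˣ+eˣ+1]
  3*ω₁*ω₂≋3/[e²ˣ+eˣ+1] = begin
    const (ιℕ 3) *ₛ (ω₁ *ₛ ω₂)
      ≈⟨ *ₛ-identityʳ _ ⟨
    const (ιℕ 3) *ₛ (ω₁ *ₛ ω₂) *ₛ 1ₛ
      ≈⟨ *ₛ-cong ≋-refl [e³ˣ-1]/3x*3x/[e³ˣ-1]≋1 ⟨
    const (ιℕ 3) *ₛ (ω₁ *ₛ ω₂) *ₛ ([e³ˣ-1]/3x *ₛ 3x/[e³ˣ-1])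
      ≈⟨ solve 3 (λ w d₃ b₃ → con (ιℕ 3) :* w :* (d₃ :* b₃) := w :* (con (ιℕ 3) :* d₃) :* b₃)
        ≋-refl (ω₁ *ₛ ω₂) [e³ˣ-1]/3x 3x/[e³ˣ-1] ⟩
    ω₁ *ₛ ω₂ *ₛ (const (ιℕ 3) *ₛ [e³ˣ-1]/3x) *ₛ 3x/[e³ˣ-1]
      ≈⟨ *ₛ-cong (*ₛ-cong ≋-refl [e²ˣ+eˣ+1]*[eˣ-1]/x≋3*[e³ˣ-1]/3x) ≋-refl ⟨
    ω₁ *ₛ ω₂ *ₛ (e²ˣ+eˣ+1 *ₛ [eˣ-1]/x) *ₛ 3x/[e³ˣ-1]
      ≈⟨ *ₛ-cong (*ₛ-cong ≋-refl (*ₛ-cong [ηeˣ-1]*[η²eˣ-1]≋e²ˣ+eˣ+1 ≋-refl)) ≋-refl ⟨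
    ω₁ *ₛ ω₂ *ₛ (c₁ *ₛ c₂ *ₛ [eˣ-1]/x) *ₛ 3x/[e³ˣ-1]
      ≈⟨ solve 6 (λ w₁ w₂ c₁ c₂ d b → w₁ :* w₂ :* (c₁ :* c₂ :* d) :* b := (c₁ :* w₁) :* (c₂ :* w₂) :* (d :* b))
        ≋-refl ω₁ ω₂ c₁ c₂ [eˣ-1]/x 3x/[e³ˣ-1] ⟩
    (c₁ *ₛ ω₁) *ₛ (c₂ *ₛ ω₂) *ₛ 3/[e²ˣ+eˣ+1]
      ≈⟨ *ₛ-cong (*ₛ-cong c₁*ω₁≋1 c₂*ω₂≋1) ≋-refl ⟩
    1ₛ *ₛ 1ₛ *ₛ 3/[e²ˣ+eˣ+1]
      ≈⟨ solve 1 (λ e → con 1₃ :* con 1₃ :* e := e) ≋-refl 3/[e²ˣ+eˣ+1] ⟩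
    3/[e²ˣ+eˣ+1]
      ∎
    where open ≋-Reasoning
          open Series-Solver

  [e²ˣ+eˣ+1]*3x/[e³ˣ-1]≋3*x/[eˣ-1] : e²ˣ+eˣ+1 *ₛ 3x/[e³ˣ-1] ≋ const (ιℕ 3) *ₛ x/[eˣ-1]
  [e²ˣ+eˣ+1]*3x/[e³ˣ-1]≋3*x/[eˣ-1] = begin
    e²ˣ+eˣ+1 *ₛ 3x/[e³ˣ-1]
      ≈⟨ *ₛ-identityʳ _ ⟨
    e²ˣ+eˣ+1 *ₛ 3x/[e³ˣ-1] *ₛ 1ₛ
      ≈⟨ *ₛ-cong ≋-refl [eˣ-1]/x*x/[eˣ-1]≋1 ⟨
    e²ˣ+eˣ+1 *ₛ 3x/[e³ˣ-1] *ₛ ([eˣ-1]/x *ₛ x/[eˣ-1])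
      ≈⟨ solve 4 (λ n b₃ d b → n :* b₃ :* (d :* b) := n :* d :* b₃ :* b) ≋-refl e²ˣ+eˣ+1 3x/[e³ˣ-1] [eˣ-1]/x x/[eˣ-1] ⟩
    e²ˣ+eˣ+1 *ₛ [eˣ-1]/x *ₛ 3x/[e³ˣ-1] *ₛ x/[eˣ-1]
      ≈⟨ *ₛ-cong (*ₛ-cong [e²ˣ+eˣ+1]*[eˣ-1]/x≋3*[e³ˣ-1]/3x ≋-refl) ≋-refl ⟩
    const (ιℕ 3) *ₛ [e³ˣ-1]/3x *ₛ 3x/[e³ˣ-1] *ₛ x/[eˣ-1]
      ≈⟨ solve 3 (λ d₃ b₃ b → con (ιℕ 3) :* d₃ :* b₃ :* b := con (ιℕ 3) :* b :* (d₃ :* b₃)) ≋-refl [e³ˣ-1]/3x 3x/[e³ˣ-1] x/[eˣ-1] ⟩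
    const (ιℕ 3) *ₛ x/[eˣ-1] *ₛ ([e³ˣ-1]/3x *ₛ 3x/[e³ˣ-1])
      ≈⟨ *ₛ-cong ≋-refl [e³ˣ-1]/3x*3x/[e³ˣ-1]≋1 ⟩
    const (ιℕ 3) *ₛ x/[eˣ-1] *ₛ 1ₛ
      ≈⟨ *ₛ-identityʳ _ ⟩
    const (ιℕ 3) *ₛ x/[eˣ-1]
      ∎
    where open ≋-Reasoning
          open Series-Solver

  3[ω₁+ω₂]≋3/[e²ˣ+eˣ+1]*[c₁+c₂] : const (ιℕ 3) *ₛ (ω₁ +ₛ ω₂) ≋ 3/[e²ˣ+eˣ+1] *ₛ (c₁ +ₛ c₂)
  3[ω₁+ω₂]≋3/[e²ˣ+eˣ+1]*[c₁+c₂] = begin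
    const (ιℕ 3) *ₛ (ω₁ +ₛ ω₂)
      ≈⟨ solve 2 (λ w₁ w₂ → con (ιℕ 3) :* (w₁ :+ w₂) := con (ιℕ 3) :* (w₁ :* con 1₃ :+ w₂ :* con 1₃)) ≋-refl ω₁ ω₂ ⟩
    const (ιℕ 3) *ₛ (ω₁ *ₛ 1ₛ +ₛ ω₂ *ₛ 1ₛ)
      ≈⟨ *ₛ-cong ≋-refl (+ₛ-cong (*ₛ-cong ≋-refl c₂*ω₂≋1) (*ₛ-cong ≋-refl c₁*ω₁≋1)) ⟨
    const (ιℕ 3) *ₛ (ω₁ *ₛ (c₂ *ₛ ω₂) +ₛ ω₂ *ₛ (c₁ *ₛ ω₁))
      ≈⟨ solve 4 (λ w₁ w₂ c₁ c₂ → con (ιℕ 3) :* (w₁ :* (c₂ :* w₂) :+ w₂ :* (c₁ :* w₁))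
        := con (ιℕ 3) :* (w₁ :* w₂) :* (c₁ :+ c₂)) ≋-refl ω₁ ω₂ c₁ c₂ ⟩
    const (ιℕ 3) *ₛ (ω₁ *ₛ ω₂) *ₛ (c₁ +ₛ c₂)
      ≈⟨ *ₛ-cong 3*ω₁*ω₂≋3/[e²ˣ+eˣ+1] ≋-refl ⟩
    3/[e²ˣ+eˣ+1] *ₛ (c₁ +ₛ c₂)
      ∎
    where open ≋-Reasoning
          open Series-Solver

  3[ω₁-ω₂]≋3/[e²ˣ+eˣ+1]*[c₂-c₁] : const (ιℕ 3) *ₛ (ω₁ -ₛ ω₂) ≋ 3/[e²ˣ+eˣ+1] *ₛ (c₂ -ₛ c₁)
  3[ω₁-ω₂]≋3/[e²ˣ+eˣ+1]*[c₂-c₁] = begin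
    const (ιℕ 3) *ₛ (ω₁ -ₛ ω₂)
      ≈⟨ solve 2 (λ w₁ w₂ → con (ιℕ 3) :* (w₁ :- w₂) := con (ιℕ 3) :* (w₁ :* con 1₃ :- w₂ :* con 1₃)) ≋-refl ω₁ ω₂ ⟩
    const (ιℕ 3) *ₛ (ω₁ *ₛ 1ₛ -ₛ ω₂ *ₛ 1ₛ)
      ≈⟨ *ₛ-cong ≋-refl (+ₛ-cong (*ₛ-cong ≋-refl c₂*ω₂≋1) (-ₛ-cong (*ₛ-cong ≋-refl c₁*ω₁≋1))) ⟨
    const (ιℕ 3) *ₛ (ω₁ *ₛ (c₂ *ₛ ω₂) -ₛ ω₂ *ₛ (c₁ *ₛ ω₁))
      ≈⟨ solve 4 (λ w₁ w₂ c₁ c₂ → con (ιℕ 3) :* (w₁ :* (c₂ :* w₂) :- w₂ :* (c₁ :* w₁))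
        := con (ιℕ 3) :* (w₁ :* w₂) :* (c₂ :- c₁)) ≋-refl ω₁ ω₂ c₁ c₂ ⟩
    const (ιℕ 3) *ₛ (ω₁ *ₛ ω₂) *ₛ (c₂ -ₛ c₁)
      ≈⟨ *ₛ-cong 3*ω₁*ω₂≋3/[e²ˣ+eˣ+1] ≋-refl ⟩
    3/[e²ˣ+eˣ+1] *ₛ (c₂ -ₛ c₁)
      ∎
    where open ≋-Reasoning
          open Series-Solver

  X*3[ω₁+ω₂]≋3[3x/[e³ˣ-1]-x/[eˣ-1]] :
    X *ₛ (const (ιℕ 3) *ₛ (ω₁ +ₛ ω₂)) ≋ const (ιℕ 3) *ₛ (3x/[e³ˣ-1] -ₛ x/[eˣ-1])
  X*3[ω₁+ω₂]≋3[3x/[e³ˣ-1]-x/[eˣ-1]] = begin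
    X *ₛ (const (ιℕ 3) *ₛ (ω₁ +ₛ ω₂))
      ≈⟨ *ₛ-cong ≋-refl 3[ω₁+ω₂]≋3/[e²ˣ+eˣ+1]*[c₁+c₂] ⟩
    X *ₛ ([eˣ-1]/x *ₛ 3x/[e³ˣ-1] *ₛ (c₁ +ₛ c₂))
      ≈⟨ solve 5 (λ x d b₃ c₁ c₂ → x :* (d :* b₃ :* (c₁ :+ c₂)) := x :* d :* b₃ :* (c₁ :+ c₂))
        ≋-refl X [eˣ-1]/x 3x/[e³ˣ-1] c₁ c₂ ⟩
    X *ₛ [eˣ-1]/x *ₛ 3x/[e³ˣ-1] *ₛ (c₁ +ₛ c₂)
      ≈⟨ *ₛ-cong (*ₛ-cong X*[eˣ-1]/x≋eˣ-1 ≋-refl) (+ₛ-cong (ceˣ-1≋ (η ^₃ 1)) (ceˣ-1≋ (η ^₃ 2))) ⟩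
    (eˣ -ₛ 1ₛ) *ₛ 3x/[e³ˣ-1] *ₛ (const (η ^₃ 1) *ₛ eˣ -ₛ 1ₛ +ₛ (const (η ^₃ 2) *ₛ eˣ -ₛ 1ₛ))
      ≈⟨ solve 2 (λ e b₃ → (e :- con 1₃) :* b₃ :* (con (η ^₃ 1) :* e :- con 1₃ :+ (con (η ^₃ 2) :* e :- con 1₃))
        := con (ιℕ 3) :* b₃ :- (e :* e :+ e :+ con 1₃) :* b₃) ≋-refl eˣ 3x/[e³ˣ-1] ⟩
    const (ιℕ 3) *ₛ 3x/[e³ˣ-1] -ₛ e²ˣ+eˣ+1 *ₛ 3x/[e³ˣ-1]
      ≈⟨ +ₛ-cong {f = const (ιℕ 3) *ₛ 3x/[e³ˣ-1]} ≋-refl (-ₛ-cong [e²ˣ+eˣ+1]*3x/[e³ˣ-1]≋3*x/[eˣ-1]) ⟩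
    const (ιℕ 3) *ₛ 3x/[e³ˣ-1] -ₛ const (ιℕ 3) *ₛ x/[eˣ-1]
      ≈⟨ solve 2 (λ b₃ b → con (ιℕ 3) :* b₃ :- con (ιℕ 3) :* b := con (ιℕ 3) :* (b₃ :- b)) ≋-refl 3x/[e³ˣ-1] x/[eˣ-1] ⟩
    const (ιℕ 3) *ₛ (3x/[e³ˣ-1] -ₛ x/[eˣ-1])
      ∎
    where open ≋-Reasoning
          open Series-Solver

  3[ω₁-ω₂]≋[η²-η]*eˣ*3/[e²ˣ+eˣ+1] :
    const (ιℕ 3) *ₛ (ω₁ -ₛ ω₂) ≋ const (η ^₃ 2 -₃ η ^₃ 1) *ₛ (eˣ *ₛ [eˣ-1]/x *ₛ 3x/[e³ˣ-1])
  3[ω₁-ω₂]≋[η²-η]*eˣ*3/[e²ˣ+eˣ+1] = begin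
    const (ιℕ 3) *ₛ (ω₁ -ₛ ω₂)
      ≈⟨ 3[ω₁-ω₂]≋3/[e²ˣ+eˣ+1]*[c₂-c₁] ⟩
    [eˣ-1]/x *ₛ 3x/[e³ˣ-1] *ₛ (c₂ -ₛ c₁)
      ≈⟨ *ₛ-cong ≋-refl (+ₛ-cong (ceˣ-1≋ (η ^₃ 2)) (-ₛ-cong (ceˣ-1≋ (η ^₃ 1)))) ⟩
    [eˣ-1]/x *ₛ 3x/[e³ˣ-1] *ₛ (const (η ^₃ 2) *ₛ eˣ -ₛ 1ₛ -ₛ (const (η ^₃ 1) *ₛ eˣ -ₛ 1ₛ))
      ≈⟨ solve 3 (λ d b₃ e → d :* b₃ :* (con (η ^₃ 2) :* e :- con 1₃ :- (con (η ^₃ 1) :* e :- con 1₃))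
                             := con (η ^₃ 2 -₃ η ^₃ 1) :* (e :* d :* b₃)) ≋-refl [eˣ-1]/x 3x/[e³ˣ-1] eˣ ⟩
    const (η ^₃ 2 -₃ η ^₃ 1) *ₛ (eˣ *ₛ [eˣ-1]/x *ₛ 3x/[e³ˣ-1])
      ∎
    where open ≋-Reasoning
          open Series-Solver

  scale[-1]c₁*scale[-1]ω₁≋1 : scale (-₃ 1₃) c₁ *ₛ scale (-₃ 1₃) ω₁ ≋ 1ₛ
  scale[-1]c₁*scale[-1]ω₁≋1 = ≋-trans (≋-sym (scale-*ₛ (-₃ 1₃) c₁ ω₁))
    (≋-trans (scale-cong (-₃ 1₃) c₁*ω₁≋1) (scale-const (-₃ 1₃) 1₃))

  -- η²eˣ(ηe⁻ˣ - 1) = 1 - η²eˣ, because η³ = 1.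
  c₂≋-η²eˣ*scale[-1]c₁ : c₂ ≋ -ₛ (const (η ^₃ 2) *ₛ eˣ *ₛ scale (-₃ 1₃) c₁)
  c₂≋-η²eˣ*scale[-1]c₁ = begin
    c₂
      ≈⟨ ceˣ-1≋ (η ^₃ 2) ⟩
    const (η ^₃ 2) *ₛ eˣ -ₛ 1ₛ
      ≈⟨ +ₛ-cong {f = const (η ^₃ 2) *ₛ eˣ} ≋-refl (-ₛ-cong eˣ*e⁻ˣ≋1) ⟨
    const (η ^₃ 2) *ₛ eˣ -ₛ eˣ *ₛ e⁻ˣ
      ≈⟨ solve 2 (λ e f → con (η ^₃ 2) :* e :- e :* f
        := :- (con (η ^₃ 2) :* e :* (con (η ^₃ 1) :* f :- con 1₃))) ≋-refl eˣ e⁻ˣ ⟩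
    -ₛ (const (η ^₃ 2) *ₛ eˣ *ₛ (const (η ^₃ 1) *ₛ e⁻ˣ -ₛ 1ₛ))
      ≈⟨ -ₛ-cong (*ₛ-cong ≋-refl (scale-ceˣ-1 (-₃ 1₃) (η ^₃ 1))) ⟨
    -ₛ (const (η ^₃ 2) *ₛ eˣ *ₛ scale (-₃ 1₃) c₁)
      ∎
    where open ≋-Reasoning
          open Series-Solver

  c₂*[-1-ω₁[-x]]≋1 : c₂ *ₛ (-ₛ 1ₛ -ₛ scale (-₃ 1₃) ω₁) ≋ 1ₛ
  c₂*[-1-ω₁[-x]]≋1 = begin
    c₂ *ₛ (-ₛ 1ₛ -ₛ s ω₁)
      ≈⟨ solve 2 (λ c w → c :* (:- con 1₃ :- w) := :- c :+ (:- c) :* w) ≋-refl c₂ (s ω₁) ⟩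
    -ₛ c₂ +ₛ (-ₛ c₂) *ₛ s ω₁
      ≈⟨ +ₛ-cong (-ₛ-cong (ceˣ-1≋ (η ^₃ 2))) (*ₛ-cong (-ₛ-cong c₂≋-η²eˣ*scale[-1]c₁) ≋-refl) ⟩
    -ₛ (const (η ^₃ 2) *ₛ eˣ -ₛ 1ₛ) +ₛ (-ₛ -ₛ (const (η ^₃ 2) *ₛ eˣ *ₛ s c₁)) *ₛ s ω₁
      ≈⟨ solve 3 (λ e c w → :- (con (η ^₃ 2) :* e :- con 1₃) :+ (:- :- (con (η ^₃ 2) :* e :* c)) :* w
        := con 1₃ :- con (η ^₃ 2) :* e :+ con (η ^₃ 2) :* e :* (c :* w)) ≋-refl eˣ (s c₁) (s ω₁) ⟩
    1ₛ -ₛ const (η ^₃ 2) *ₛ eˣ +ₛ const (η ^₃ 2) *ₛ eˣ *ₛ (s c₁ *ₛ s ω₁)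
      ≈⟨ +ₛ-cong {f = 1ₛ -ₛ const (η ^₃ 2) *ₛ eˣ} ≋-refl (*ₛ-cong ≋-refl scale[-1]c₁*scale[-1]ω₁≋1) ⟩
    1ₛ -ₛ const (η ^₃ 2) *ₛ eˣ +ₛ const (η ^₃ 2) *ₛ eˣ *ₛ 1ₛ
      ≈⟨ solve 1 (λ e → con 1₃ :- con (η ^₃ 2) :* e :+ con (η ^₃ 2) :* e :* con 1₃ := con 1₃) ≋-refl eˣ ⟩
    1ₛ
      ∎
    where open ≋-Reasoning
          open Series-Solver
          s : Series → Series
          s = scale (-₃ 1₃)

  ω₂≋-1-ω₁[-x] : ω₂ ≋ -ₛ 1ₛ -ₛ scale (-₃ 1₃) ω₁
  ω₂≋-1-ω₁[-x] = *ₛ-inverse-unique c₂*ω₂≋1 c₂*[-1-ω₁[-x]]≋1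

  ω-odd : ∀ d → ω₁ (suc (double d)) ≡ ω₂ (suc (double d))
  ω-odd d = sym (begin
    ω₂ k
      ≡⟨ ω₂≋-1-ω₁[-x] k ⟩
    -₃ 0₃ +₃ -₃ ((-₃ 1₃ *₃ (-₃ 1₃) ^₃ double d) *₃ ω₁ k)
      ≡⟨ cong (λ p → -₃ 0₃ +₃ -₃ ((-₃ 1₃ *₃ p) *₃ ω₁ k)) ([-1]^double≡1 d) ⟩
    -₃ 0₃ +₃ -₃ ((-₃ 1₃ *₃ 1₃) *₃ ω₁ k)
      ≡⟨ solve 1 (λ w → :- con 0₃ :+ :- ((:- con 1₃ :* con 1₃) :* w) := w) refl (ω₁ k) ⟩
    ω₁ k
      ∎)
    where open ≡-Reasoning
          open ℚ[√-3]-Solver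
          k : ℕ
          k = suc (double d)

  ω-even : ∀ d → ω₁ (double (suc d)) ≡ -₃ ω₂ (double (suc d))
  ω-even d = sym (begin
    -₃ ω₂ K
      ≡⟨ cong (λ x → -₃ x) (ω₂≋-1-ω₁[-x] K) ⟩
    -₃ (-₃ 0₃ +₃ -₃ ((-₃ 1₃ *₃ (-₃ 1₃ *₃ (-₃ 1₃) ^₃ double d)) *₃ ω₁ K))
      ≡⟨ cong (λ p → -₃ (-₃ 0₃ +₃ -₃ ((-₃ 1₃ *₃ (-₃ 1₃ *₃ p)) *₃ ω₁ K))) ([-1]^double≡1 d) ⟩
    -₃ (-₃ 0₃ +₃ -₃ ((-₃ 1₃ *₃ (-₃ 1₃ *₃ 1₃)) *₃ ω₁ K))
      ≡⟨ solve 1 (λ w → :- (:- con 0₃ :+ :- ((:- con 1₃ :* (:- con 1₃ :* con 1₃)) :* w)) := w) refl (ω₁ K) ⟩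
    ω₁ K
      ∎)
    where open ≡-Reasoning
          open ℚ[√-3]-Solver
          K : ℕ
          K = double (suc d)

  ω₁-zero : ω₁ 0 ≡ ι ((+ 1) / 3) *₃ (η ^₃ 2 -₃ 1₃)
  ω₁-zero = begin
    ω₁ 0                    ≡⟨ *₃-identityˡ (ω₁ 0) ⟨
    1₃ *₃ ω₁ 0              ≡⟨⟩  -- ((η² - 1)/3)(η - 1) computes to 1
    (r *₃ c₁ 0) *₃ ω₁ 0     ≡⟨ *₃-assoc r (c₁ 0) (ω₁ 0) ⟩
    r *₃ (c₁ *ₛ ω₁) 0       ≡⟨ cong (r *₃_) (c₁*ω₁≋1 0) ⟩
    r *₃ 1₃                 ≡⟨ *₃-identityʳ r ⟩
    r                       ∎
    where open ≡-Reasoning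
          r : Q3
          r = ι ((+ 1) / 3) *₃ (η ^₃ 2 -₃ 1₃)

  ω₁-odd : ∀ d → ω₁ (suc (double d))
                   ≡ ι (fromℕ (3 ^ double (suc d) ∸ 1) ℚ.* B (double (suc d)) ℚ.* ((+ 1) / (4 * suc d)))
  ω₁-odd d = begin
    t                                   ≡⟨ [1+n]*x≡y⇒x≡y/[1+n] (ℕ.pred (4 * suc d)) [4+4d]*t≡[3^K-1]*β ⟩
    ι r *₃ (ιℕ (3 ^ K ∸ 1) *₃ β)        ≡⟨ *₃-comm (ι r) (ιℕ (3 ^ K ∸ 1) *₃ β) ⟩
    ιℕ (3 ^ K ∸ 1) *₃ β *₃ ι r          ≡⟨ cong (_*₃ ι r) (ι-* (fromℕ (3 ^ K ∸ 1)) (B K)) ⟨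
    ι (fromℕ (3 ^ K ∸ 1) ℚ.* B K) *₃ ι r ≡⟨ ι-* (fromℕ (3 ^ K ∸ 1) ℚ.* B K) r ⟨
    ι (fromℕ (3 ^ K ∸ 1) ℚ.* B K ℚ.* r)  ∎
    where
    open ≡-Reasoning
    open ℚ[√-3]-Solver
    k K : ℕ
    k = suc (double d)
    K = suc k
    t β : Q3
    t = ω₁ k
    β = ι (B K)
    r : ℚ
    r = (+ 1) / (4 * suc d)

    3[K*[t+t]]≡3[[3^K-1]*β] : ιℕ 3 *₃ (ιℕ K *₃ (t +₃ t)) ≡ ιℕ 3 *₃ ((ιℕ 3 ^₃ K -₃ 1₃) *₃ β)
    3[K*[t+t]]≡3[[3^K-1]*β] = begin
      ιℕ 3 *₃ (ιℕ K *₃ (t +₃ t))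
        ≡⟨ solve 3 (λ a c t → a :* (c :* (t :+ t)) := c :* (a :* (t :+ t))) refl (ιℕ 3) (ιℕ K) t ⟩
      ιℕ K *₃ (ιℕ 3 *₃ (t +₃ t))
        ≡⟨ cong (λ u → ιℕ K *₃ (ιℕ 3 *₃ (t +₃ u))) (ω-odd d) ⟩
      ιℕ K *₃ (ιℕ 3 *₃ (t +₃ ω₂ k))
        ≡⟨ trans (X*ₛ-suc _ k) (cong (ιℕ K *₃_) (const-*ₛ (ιℕ 3) (ω₁ +ₛ ω₂) k)) ⟨
      (X *ₛ (const (ιℕ 3) *ₛ (ω₁ +ₛ ω₂))) K
        ≡⟨ X*3[ω₁+ω₂]≋3[3x/[e³ˣ-1]-x/[eˣ-1]] K ⟩
      (const (ιℕ 3) *ₛ (3x/[e³ˣ-1] -ₛ x/[eˣ-1])) K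
        ≡⟨ const-*ₛ (ιℕ 3) (3x/[e³ˣ-1] -ₛ x/[eˣ-1]) K ⟩
      ιℕ 3 *₃ (ιℕ 3 ^₃ K *₃ β -₃ β)
        ≡⟨ solve 3 (λ a p b → a :* (p :* b :- b) := a :* ((p :- con 1₃) :* b)) refl (ιℕ 3) (ιℕ 3 ^₃ K) β ⟩
      ιℕ 3 *₃ ((ιℕ 3 ^₃ K -₃ 1₃) *₃ β)
        ∎

    [4+4d]*t≡[3^K-1]*β : ιℕ (4 * suc d) *₃ t ≡ ιℕ (3 ^ K ∸ 1) *₃ β
    [4+4d]*t≡[3^K-1]*β = begin
      ιℕ (4 * suc d) *₃ t
        ≡⟨ cong (λ n → ιℕ n *₃ t) (trans (ℕP.*-assoc 2 2 (suc d)) (cong (2 *_) (sym (double≡2* (suc d))))) ⟩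
      ιℕ (2 * K) *₃ t
        ≡⟨ cong (_*₃ t) (ιℕ-* 2 K) ⟩
      ιℕ 2 *₃ ιℕ K *₃ t
        ≡⟨ solve 2 (λ c t → con (ιℕ 2) :* c :* t := c :* (t :+ t)) refl (ιℕ K) t ⟩
      ιℕ K *₃ (t +₃ t)
        ≡⟨ *-cancelˡ-ιℕ[1+n] 2 3[K*[t+t]]≡3[[3^K-1]*β] ⟩
      (ιℕ 3 ^₃ K -₃ 1₃) *₃ β
        ≡⟨ cong (λ p → (p -₃ 1₃) *₃ β) (ιℕ-^ 3 K) ⟨
      (ιℕ (3 ^ K) -₃ 1₃) *₃ β
        ≡⟨ cong (_*₃ β) (ιℕ-∸1 (ℕP.m^n>0 3 K)) ⟨
      ιℕ (3 ^ K ∸ 1) *₃ β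
        ∎

  ω₁-even : ∀ d → ω₁ (double (suc d))
                    ≡ -₃ (√-3 *₃ ι ((+ 1) / (6 * (double (suc d) + 1)) ℚ.* evenSum B (double (suc d))))
  ω₁-even d = begin
    z
      ≡⟨ [1+n]*x≡y⇒x≡y/[1+n] (ℕ.pred (6 * (K + 1))) [6K+6]*z≡-√-3*Σ ⟩
    ι r *₃ (-₃ (√-3 *₃ ι Σ))
      ≡⟨ solve 3 (λ r s σ → r :* (:- (s :* σ)) := :- (s :* (r :* σ))) refl (ι r) √-3 (ι Σ) ⟩
    -₃ (√-3 *₃ (ι r *₃ ι Σ))
      ≡⟨ cong (λ x → -₃ (√-3 *₃ x)) (ι-* r Σ) ⟨
    -₃ (√-3 *₃ ι (r ℚ.* Σ))
      ∎
    where
    open ≡-Reasoning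
    open ℚ[√-3]-Solver
    K : ℕ
    K = double (suc d)
    z : Q3
    z = ω₁ K
    r Σ : ℚ
    r = (+ 1) / (6 * (K + 1))
    Σ = evenSum B K
    e : Series
    e = eˣ *ₛ [eˣ-1]/x *ₛ 3x/[e³ˣ-1]

    [6K+6]*z≡-√-3*Σ : ιℕ (6 * (K + 1)) *₃ z ≡ -₃ (√-3 *₃ ι Σ)
    [6K+6]*z≡-√-3*Σ = begin
      ιℕ (6 * (K + 1)) *₃ z
        ≡⟨ cong (λ n → ιℕ (6 * n) *₃ z) (ℕP.+-comm K 1) ⟩
      ιℕ (6 * suc K) *₃ z
        ≡⟨ cong (_*₃ z) (ιℕ-* 6 (suc K)) ⟩
      ιℕ 6 *₃ ιℕ (suc K) *₃ z
        ≡⟨ solve 2 (λ c z → con (ιℕ 6) :* c :* z := c :* (con (ιℕ 3) :* (z :+ z))) refl (ιℕ (suc K)) z ⟩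
      ιℕ (suc K) *₃ (ιℕ 3 *₃ (z +₃ z))
        ≡⟨ cong (λ u → ιℕ (suc K) *₃ (ιℕ 3 *₃ (z +₃ u))) (ω-even d) ⟩
      ιℕ (suc K) *₃ (ιℕ 3 *₃ (z -₃ ω₂ K))
        ≡⟨ cong (ιℕ (suc K) *₃_) (const-*ₛ (ιℕ 3) (ω₁ -ₛ ω₂) K) ⟨
      ιℕ (suc K) *₃ (const (ιℕ 3) *ₛ (ω₁ -ₛ ω₂)) K
        ≡⟨ cong (ιℕ (suc K) *₃_) (3[ω₁-ω₂]≋[η²-η]*eˣ*3/[e²ˣ+eˣ+1] K) ⟩
      ιℕ (suc K) *₃ (const (η ^₃ 2 -₃ η ^₃ 1) *ₛ e) K
        ≡⟨ cong (ιℕ (suc K) *₃_) (const-*ₛ (η ^₃ 2 -₃ η ^₃ 1) e K) ⟩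
      ιℕ (suc K) *₃ ((η ^₃ 2 -₃ η ^₃ 1) *₃ e K)
        ≡⟨ solve 2 (λ c x → c :* ((con (η ^₃ 2) :- con (η ^₃ 1)) :* x) := :- (con √-3 :* (c :* x))) refl (ιℕ (suc K)) (e K) ⟩
      -₃ (√-3 *₃ (ιℕ (suc K) *₃ e K))
        ≡⟨ cong (λ x → -₃ (√-3 *₃ x)) (ι-evenSum B K) ⟨
      -₃ (√-3 *₃ ι Σ)
        ∎

lemma4p4 : (B : ℕ → ℚ) → (ω₁ ω₂ : ℕ → Q3) → IsBernoulli B → IsOmega3 1 ω₁ → IsOmega3 2 ω₂ →
    (ω₁ 0 ≡ ι ((+ 1) / 3) *₃ ((η ^₃ 2) -₃ 1₃))
    × (∀ m → let n = suc m in
        (ω₁ (2 * n ∸ 1) ≡ ω₂ (2 * n ∸ 1))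
        × (ω₁ (2 * n ∸ 1) ≡ ι (fromℕ (3 ^ (2 * n) ∸ 1) ℚ.* B (2 * n) ℚ.* ((+ 1) / (4 * n))))
        × (ω₁ (2 * n) ≡ -₃ ω₂ (2 * n))
        × (ω₁ (2 * n) ≡ -₃ (√-3 *₃ ι (((+ 1) / (6 * (2 * n + 1)))
              ℚ.* sumQ (2 * n) (λ j → fromℕ (3 ^ (2 * n ∸ j)) ℚ.* fromℕ (2 ^ (j + 1) ∸ 1)
                  ℚ.* fromℕ ((2 * n + 1) C (2 * n ∸ j)) ℚ.* B (2 * n ∸ j))))))
lemma4p4 B ω₁ ω₂ isB isω₁ isω₂ = ω₁-zero , λ m →
  subst (Claim m) (double≡2* (suc m)) (ω-odd m , ω₁-odd m , ω-even m , ω₁-even m)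
  where
  open Omega3 B ω₁ ω₂ isB isω₁ isω₂

  6*[K+1]≢0 : ∀ K → ℕ.NonZero (6 * (K + 1))
  6*[K+1]≢0 K = subst (λ n → ℕ.NonZero (6 * n)) (ℕP.+-comm 1 K) ℕ.nonZero

  Claim : ℕ → ℕ → Set
  Claim m K = (ω₁ (K ∸ 1) ≡ ω₂ (K ∸ 1))
            × (ω₁ (K ∸ 1) ≡ ι (fromℕ (3 ^ K ∸ 1) ℚ.* B K ℚ.* ((+ 1) / (4 * suc m))))
            × (ω₁ K ≡ -₃ ω₂ K)
            × (ω₁ K ≡ -₃ (√-3 *₃ ι (((+ 1) / (6 * (K + 1))) {{6*[K+1]≢0 K}} ℚ.* evenSum B K)))
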